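{- Let $1\le k\le n-1$ be integers and let $D_{k,n}(t)$ be the Ehrhart polynomial of the matroid polytope of the minimal matroid $T_{k,n}$. Then \[ D_{k,n}(t) = \binom{t+n-k}{n-k} \sum_{j=0}^{k-1} \frac{n-k}{n-k+j} \binom{t}{j}\binom{k-1}{j}.\]
   Context: For integers $1\le k\le n-1$, $T_{k,n}$ denotes the cycle matroid of the graph obtained from a cycle of length $k+1$ by replacing one of its edges with $n-k$ parallel edges. For a matroid $M$ on $\{1,\dots,n\}$, its matroid polytope is $\mathscr{P}(M)=\operatorname{conv}\{\sum_{i\in B}e_i : B \text{ a basis of } M\}\subseteq\mathbb{R}^n$, and its Ehrhart polynomial is the polynomial $i(t)$ with $i(t)=\#(t\mathscr{P}(M)\cap\mathbb{Z}^n)$ for all integers $t\ge0$. -}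

module Defs where

open import Data.Bool using (Bool; true; false; if_then_else_)
open import Data.Nat as ℕ using (ℕ; zero; suc; _<ᵇ_; _∸_)
open import Data.Nat.Combinatorics using (_C_)
open import Data.Integer as ℤ using (ℤ; +_)
open import Data.Rational as ℚ using (ℚ; 0ℚ; 1ℚ; _/_)
open import Data.Fin using (Fin; toℕ)
open import Data.Vec using (Vec; lookup)
open import Data.List using (List; []; _∷_; upTo; map; foldr; length)
open import Data.List.Relation.Unary.All using (All)
open import Data.List.Relation.Unary.Unique.Propositional using (Unique)
open import Data.List.Membership.Propositional using (_∈_)
open import Data.Product using (Σ; _×_; _,_; proj₁; proj₂)
open import Data.Sum using (_⊎_)
open import Relation.Binary.PropositionalEquality using (_≡_)
open import Function.Bundles using (_⇔_)

-- The graph G_{k,n}: a cycle of length k+1 on vertices 0,1,…,k with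
-- edges {0,1},{1,2},…,{k-1,k},{k,0}, where the edge {k,0} is replaced
-- by n-k parallel edges.

endA : (k n : ℕ) → Fin n → ℕ
endA k n i = if toℕ i <ᵇ k then toℕ i else k

endB : (k n : ℕ) → Fin n → ℕ
endB k n i = if toℕ i <ᵇ k then suc (toℕ i) else 0

data Reach (k n : ℕ) (F : Vec Bool n) : ℕ → ℕ → Set where
  here : ∀ {u} → Reach k n F u u
  step : ∀ {u v} (e : Fin n) → lookup F e ≡ true →
         ((endA k n e ≡ u × endB k n e ≡ v) ⊎ (endB k n e ≡ u × endA k n e ≡ v)) →
         ∀ {w} → Reach k n F v w → Reach k n F u w

card : ∀ {n} → Vec Bool n → ℕ
card Data.Vec.[] = 0
card (b Data.Vec.∷ bs) = (if b then 1 else 0) ℕ.+ card bs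

IsSpanningTree : (k n : ℕ) → Vec Bool n → Set
IsSpanningTree k n F = card F ≡ k × (∀ v → v ℕ.≤ k → Reach k n F 0 v)

-- T_{k,n} is the cycle matroid of the (connected) graph G_{k,n};
-- its bases are exactly the spanning trees of G_{k,n}.
IsBasisT : (k n : ℕ) → Vec Bool n → Set
IsBasisT = IsSpanningTree

indicator : ∀ {n} → Vec Bool n → Fin n → ℚ
indicator B i = if lookup B i then 1ℚ else 0ℚ

ℕtoℚ : ℕ → ℚ
ℕtoℚ m = (+ m) / 1

ℤtoℚ : ℤ → ℚ
ℤtoℚ z = z / 1

sumℚ : List ℚ → ℚ
sumℚ = foldr ℚ._+_ 0ℚ

InDilatedPolytope : (k n : ℕ) (t : ℕ) → (Fin n → ℚ) → Set
InDilatedPolytope k n t x =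
  Σ (List (ℚ × Vec Bool n)) λ L →
    All (λ p → 0ℚ ℚ.≤ proj₁ p × IsBasisT k n (proj₂ p)) L
    × sumℚ (map proj₁ L) ≡ 1ℚ
    × (∀ i → x i ≡ ℕtoℚ t ℚ.* sumℚ (map (λ p → proj₁ p ℚ.* indicator (proj₂ p) i) L))

LatticePoint : (k n t : ℕ) → Vec ℤ n → Set
LatticePoint k n t z = InDilatedPolytope k n t (λ i → ℤtoℚ (lookup z i))

HasCardinality : ∀ {A : Set} → (A → Set) → ℕ → Set
HasCardinality {A} P N =
  Σ (List A) λ xs → Unique xs × (∀ x → (x ∈ xs) ⇔ P x) × length xs ≡ N

-- a / b as a rational (b is always nonzero where used)
ratio : ℕ → ℕ → ℚ
ratio a zero = 0ℚ
ratio a (suc b) = (+ a) / suc b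

Dformula : (k n t : ℕ) → ℚ
Dformula k n t =
  ℕtoℚ ((t ℕ.+ (n ∸ k)) C (n ∸ k)) ℚ.*
  sumℚ (map (λ j → ratio (n ∸ k) ((n ∸ k) ℕ.+ j) ℚ.*
                    ℕtoℚ (t C j) ℚ.* ℕtoℚ ((k ∸ 1) C j))
            (upTo k))

-- A basis of T_{k,n} is a spanning tree of the (k+1)-cycle whose last edge is
-- replaced by m = n − k parallel edges: either the k path edges, or the path
-- minus one edge i together with one parallel edge p.  Every lattice point of
-- t·P(T_{k,n}) therefore has coordinates t − dᵢ on the path edges and bₚ on the
-- parallel edges, with d, b ≥ 0 and Σd = Σb ≤ t: the coordinates of t times a
-- convex combination of 0/1 vectors lie in [0, t], every basis has k edges, and
-- at most one of them is parallel.  Conversely such a point is a sum of t bases,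
-- built greedily by exchanging a path edge i with dᵢ > 0 for a parallel edge p
-- with bₚ > 0.  Hence D_{k,n}(t) = Σ_{s ≤ t} C(s+k−1, k−1) C(s+m−1, m−1).
-- Expanding C(s+k−1, k−1) = Σ_j C(k−1, j) C(s, j) by Vandermonde's identity and
-- summing over s by trinomial revision and the hockey-stick identity gives
-- Σ_{s ≤ t} C(s+m−1, m−1) C(s, j) = m/(m+j) · C(t+m, m) C(t, j).

module Submission where

open import Defs
open import Algebra.Bundles using (AbelianGroup; Ring)
open import Data.Bool using (Bool; true; false; if_then_else_)
open import Data.Bool.Properties using (T-≡; ¬-not)
open import Data.Fin as Fin using (Fin; toℕ; fromℕ<; _↑ˡ_; _↑ʳ_)
open import Data.Fin.Properties as Finₚ using (toℕ<n; toℕ-fromℕ; toℕ-inject₁; toℕ-↑ˡ; toℕ-↑ʳ; toℕ-fromℕ<; toℕ-injective)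
open import Data.Integer as ℤ using (ℤ; 0ℤ; ∣_∣)
import Data.Integer.Properties as ℤP
open import Data.List as List using (List; []; _∷_; map; length; cartesianProduct; applyUpTo; upTo)
import Data.List.Properties as Listₚ
open import Data.List.Membership.Propositional using (_∈_)
open import Data.List.Membership.Propositional.Properties using (∈-++⁺ˡ; ∈-++⁺ʳ; ∈-++⁻; ∈-map⁺; ∈-map⁻; ∈-cartesianProduct⁺; ∈-cartesianProduct⁻)
open import Data.List.Relation.Unary.All as All using (All; []; _∷_)
import Data.List.Relation.Unary.All.Properties as Allₚ
open import Data.List.Relation.Unary.AllPairs using ([]; _∷_)
open import Data.List.Relation.Unary.Any using (here)
open import Data.List.Relation.Unary.Unique.Propositional using (Unique)
import Data.List.Relation.Unary.Unique.Propositional.Properties as Uniqueₚ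
open import Data.Nat using (ℕ; zero; suc; _+_; _*_; _∸_; _≤_; _<_; _<ᵇ_; z≤n; s≤s; _≤?_)
open import Data.Nat.Combinatorics using (_C_; nCk≡nC[n∸k]; k>n⇒nCk≡0; nC1≡n; nCn≡1; nCk+nC[k+1]≡[n+1]C[k+1])
open import Data.Nat.Properties
open import Data.Nat.Tactic.RingSolver using (solve-∀)
open import Data.Product using (Σ; _×_; _,_; proj₁; proj₂; uncurry)
open import Data.Rational as ℚ using (ℚ; 0ℚ; 1ℚ; toℚᵘ)
import Data.Rational.Properties as ℚP
open import Data.Rational.Solver using (module +-*-Solver)
open import Data.Rational.Unnormalised as ℚᵘ using (mkℚᵘ; *≡*; *≤*)
import Data.Rational.Unnormalised.Properties as ℚᵘP
open import Data.Sum using (_⊎_; inj₁; inj₂)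
open import Data.Vec as Vec using (Vec; []; _∷_; lookup; _++_; replicate; _[_]≔_)
import Data.Vec.Properties as Vecₚ
open import Function using (_∘_)
open import Function.Bundles using (Equivalence; mk⇔)
open import Relation.Binary.PropositionalEquality
open import Relation.Nullary using (¬_; yes; no; contradiction)
open import Algebra.Properties.Group (AbelianGroup.group ℤP.+-0-abelianGroup) using (∙-cancelˡ)
open import Algebra.Properties.Semiring.Sum +-*-semiring
import Algebra.Properties.Semiring.Sum (Ring.semiring ℚP.+-*-ring) as ℚΣ

-- Binomial identities

pascal : ∀ n k → suc n C suc k ≡ n C k + n C suc k
pascal n k = sym (nCk+nC[k+1]≡[n+1]C[k+1] n k)

_⋆_ : (ℕ → ℕ) → (ℕ → ℕ) → ℕ → ℕ
(f ⋆ g) zero    = f 0 * g 0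
(f ⋆ g) (suc r) = f 0 * g (suc r) + ((f ∘ suc) ⋆ g) r

⋆-congˡ : ∀ {f f′} g → (∀ i → f i ≡ f′ i) → ∀ r → (f ⋆ g) r ≡ (f′ ⋆ g) r
⋆-congˡ g f≗f′ zero    = cong (_* g 0) (f≗f′ 0)
⋆-congˡ g f≗f′ (suc r) = cong₂ _+_ (cong (_* _) (f≗f′ 0)) (⋆-congˡ g (f≗f′ ∘ suc) r)

⋆-zeroˡ : ∀ {f} g → (∀ i → f i ≡ 0) → ∀ r → (f ⋆ g) r ≡ 0
⋆-zeroˡ g f≗0 r = trans (⋆-congˡ g f≗0 r) (zero⋆ r)
  where
  zero⋆ : ∀ r → ((λ _ → 0) ⋆ g) r ≡ 0
  zero⋆ zero    = refl
  zero⋆ (suc r) = zero⋆ r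

⋆-distribʳ-+ : ∀ f f′ g r → ((λ i → f i + f′ i) ⋆ g) r ≡ (f ⋆ g) r + (f′ ⋆ g) r
⋆-distribʳ-+ f f′ g zero    = *-distribʳ-+ (g 0) (f 0) (f′ 0)
⋆-distribʳ-+ f f′ g (suc r) = begin
  (f 0 + f′ 0) * g (suc r) + ((λ i → f (suc i) + f′ (suc i)) ⋆ g) r
    ≡⟨ cong₂ _+_ (*-distribʳ-+ (g (suc r)) (f 0) (f′ 0)) (⋆-distribʳ-+ (f ∘ suc) (f′ ∘ suc) g r) ⟩
  f 0 * g (suc r) + f′ 0 * g (suc r) + (((f ∘ suc) ⋆ g) r + ((f′ ∘ suc) ⋆ g) r)
    ≡⟨ +-interchange (f 0 * g (suc r)) _ _ _ ⟩
  (f ⋆ g) (suc r) + (f′ ⋆ g) (suc r) ∎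
  where
  open ≡-Reasoning
  +-interchange : ∀ a b c d → a + b + (c + d) ≡ a + c + (b + d)
  +-interchange = solve-∀

⋆-as-∑ : ∀ f g r → (f ⋆ g) r ≡ ∑[ i < suc r ] (f (toℕ i) * g (r ∸ toℕ i))
⋆-as-∑ f g zero    = sym (+-identityʳ _)
⋆-as-∑ f g (suc r) = cong (f 0 * g (suc r) +_) (⋆-as-∑ (f ∘ suc) g r)

vandermonde : ∀ a b r → (a + b) C r ≡ ((a C_) ⋆ (b C_)) r
vandermonde zero    b zero    = sym (+-identityʳ _)
vandermonde zero    b (suc r) = sym (begin
  b C suc r + 0 + ((λ i → 0 C suc i) ⋆ (b C_)) r ≡⟨ cong (b C suc r + 0 +_) (⋆-zeroˡ (b C_) 0Csuc≡0 r) ⟩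
  b C suc r + 0 + 0                               ≡⟨ +-identityʳ _ ⟩
  b C suc r + 0                                   ≡⟨ +-identityʳ _ ⟩
  b C suc r                                       ∎)
  where
  open ≡-Reasoning
  0Csuc≡0 : ∀ i → 0 C suc i ≡ 0
  0Csuc≡0 i = k>n⇒nCk≡0 {0} {suc i} (s≤s z≤n)
vandermonde (suc a) b zero    = refl
vandermonde (suc a) b (suc r) = begin
  suc (a + b) C suc r                                      ≡⟨ pascal (a + b) r ⟩
  (a + b) C r + (a + b) C suc r                            ≡⟨ cong₂ _+_ (vandermonde a b r) (vandermonde a b (suc r)) ⟩
  ((a C_) ⋆ (b C_)) r + ((a C_) ⋆ (b C_)) (suc r)          ≡⟨ +-comm (((a C_) ⋆ (b C_)) r) _ ⟩
  ((a C_) ⋆ (b C_)) (suc r) + (shifted ⋆ (b C_)) (suc r)   ≡⟨ ⋆-distribʳ-+ (a C_) shifted (b C_) (suc r) ⟨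
  ((λ i → a C i + shifted i) ⋆ (b C_)) (suc r)             ≡⟨ ⋆-congˡ (b C_) pascal-shifted (suc r) ⟩
  ((suc a C_) ⋆ (b C_)) (suc r)                            ∎
  where
  open ≡-Reasoning
  -- (shifted ⋆ g) (suc r) reduces to ((a C_) ⋆ g) r.
  shifted : ℕ → ℕ
  shifted zero    = 0
  shifted (suc i) = a C i
  pascal-shifted : ∀ i → a C i + shifted i ≡ suc a C i
  pascal-shifted zero    = refl
  pascal-shifted (suc i) = trans (+-comm (a C suc i) (a C i)) (sym (pascal a i))

binomial-as-∑ : ∀ s K → (s + K) C K ≡ ∑[ j < suc K ] ((K C toℕ j) * (s C toℕ j))
binomial-as-∑ s K = begin
  (s + K) C K                                        ≡⟨ vandermonde s K K ⟩
  ((s C_) ⋆ (K C_)) K                                ≡⟨ ⋆-as-∑ (s C_) (K C_) K ⟩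
  ∑[ j < suc K ] ((s C toℕ j) * (K C (K ∸ toℕ j)))≡⟨ sum-cong-≗ symmetric ⟩
  ∑[ j < suc K ] ((K C toℕ j) * (s C toℕ j))               ∎
  where
  open ≡-Reasoning
  symmetric : ∀ (j : Fin (suc K)) → (s C toℕ j) * (K C (K ∸ toℕ j)) ≡ (K C toℕ j) * (s C toℕ j)
  symmetric j = trans (cong ((s C toℕ j) *_) (sym (nCk≡nC[n∸k] (≤-pred (toℕ<n j))))) (*-comm (s C toℕ j) _)

absorption : ∀ n k → suc k * (suc n C suc k) ≡ suc n * (n C k)
absorption n       zero    = trans (*-identityˡ _) (trans (nC1≡n (suc n)) (sym (*-identityʳ (suc n))))
absorption zero    (suc k) = begin
  suc (suc k) * (1 C suc (suc k)) ≡⟨ cong (suc (suc k) *_) (k>n⇒nCk≡0 {1} {suc (suc k)} (s≤s (s≤s z≤n))) ⟩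
  suc (suc k) * 0                 ≡⟨ *-zeroʳ (suc (suc k)) ⟩
  0                               ≡⟨ cong (1 *_) (k>n⇒nCk≡0 {0} {suc k} (s≤s z≤n)) ⟨
  1 * (0 C suc k)                 ∎
  where open ≡-Reasoning
absorption (suc n) (suc k) = begin
  suc (suc k) * (suc (suc n) C suc (suc k))         ≡⟨ cong (suc (suc k) *_) (pascal (suc n) (suc k)) ⟩
  suc (suc k) * (X + suc n C suc (suc k))           ≡⟨ split (suc k) X (suc n C suc (suc k)) ⟩
  X + suc k * X + suc (suc k) * (suc n C suc (suc k))≡⟨ cong₂ (λ u v → X + u + v) (absorption n k) (absorption n (suc k)) ⟩
  X + suc n * (n C k) + suc n * (n C suc k)         ≡⟨ merge X (suc n) (n C k) (n C suc k) ⟩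
  X + suc n * (n C k + n C suc k)                   ≡⟨ cong (λ u → X + suc n * u) (pascal n k) ⟨
  X + suc n * X                                     ∎
  where
  open ≡-Reasoning
  X = suc n C suc k
  split : ∀ a x y → (1 + a) * (x + y) ≡ x + a * x + (1 + a) * y
  split = solve-∀
  merge : ∀ x a b c → x + a * b + a * c ≡ x + a * (b + c)
  merge = solve-∀

trinomial-revision : ∀ x j c → ((x + c) C (j + c)) * ((j + c) C c) ≡ ((x + c) C c) * (x C j)
trinomial-revision x j zero
  rewrite +-identityʳ x | +-identityʳ j = trans (*-identityʳ (x C j)) (sym (*-identityˡ (x C j)))
trinomial-revision x j (suc c) rewrite +-suc x c | +-suc j c = *-cancelˡ-≡ _ _ (suc c) (begin
  suc c * (A * B)                                 ≡⟨ x[yz]≡y[xz] (suc c) A B ⟩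
  A * (suc c * B)                                 ≡⟨ cong (A *_) (absorption (j + c) c) ⟩
  A * (suc (j + c) * ((j + c) C c))               ≡⟨ x[yz]≡[yx]z A (suc (j + c)) ((j + c) C c) ⟩
  (suc (j + c) * A) * ((j + c) C c)               ≡⟨ cong (_* ((j + c) C c)) (absorption (x + c) (j + c)) ⟩
  (suc (x + c) * ((x + c) C (j + c))) * ((j + c) C c) ≡⟨ *-assoc (suc (x + c)) ((x + c) C (j + c)) ((j + c) C c) ⟩
  suc (x + c) * (((x + c) C (j + c)) * ((j + c) C c)) ≡⟨ cong (suc (x + c) *_) (trinomial-revision x j c) ⟩
  suc (x + c) * (((x + c) C c) * (x C j))         ≡⟨ *-assoc (suc (x + c)) ((x + c) C c) (x C j) ⟨
  (suc (x + c) * ((x + c) C c)) * (x C j)         ≡⟨ cong (_* (x C j)) (absorption (x + c) c) ⟨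
  (suc c * (suc (x + c) C suc c)) * (x C j)       ≡⟨ *-assoc (suc c) (suc (x + c) C suc c) (x C j) ⟩
  suc c * ((suc (x + c) C suc c) * (x C j))       ∎)
  where
  open ≡-Reasoning
  A = suc (x + c) C suc (j + c)
  B = suc (j + c) C suc c
  x[yz]≡y[xz] : ∀ x y z → x * (y * z) ≡ y * (x * z)
  x[yz]≡y[xz] = solve-∀
  x[yz]≡[yx]z : ∀ x y z → x * (y * z) ≡ (y * x) * z
  x[yz]≡[yx]z = solve-∀

∑-snoc : ∀ n (f : ℕ → ℕ) → ∑[ i < suc n ] f (toℕ i) ≡ ∑[ i < n ] f (toℕ i) + f n
∑-snoc n f = trans (sum-init-last (f ∘ toℕ))
  (cong₂ _+_ (sum-cong-≗ {n} (cong f ∘ toℕ-inject₁)) (cong f (toℕ-fromℕ n)))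

hockey-stick : ∀ t j M → ∑[ s < suc t ] ((toℕ s + M) C (j + M)) ≡ suc (t + M) C suc (j + M)
hockey-stick zero    j M = begin
  M C (j + M) + 0               ≡⟨ cong (M C (j + M) +_) (k>n⇒nCk≡0 {M} {suc (j + M)} (s≤s (m≤n+m M j))) ⟨
  M C (j + M) + M C suc (j + M) ≡⟨ pascal M (j + M) ⟨
  suc M C suc (j + M)           ∎
  where open ≡-Reasoning
hockey-stick (suc t) j M = begin
  ∑[ s < suc (suc t) ] ((toℕ s + M) C (j + M))
    ≡⟨ ∑-snoc (suc t) (λ s → (s + M) C (j + M)) ⟩
  ∑[ s < suc t ] ((toℕ s + M) C (j + M)) + suc (t + M) C (j + M)
    ≡⟨ cong (_+ suc (t + M) C (j + M)) (hockey-stick t j M) ⟩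
  suc (t + M) C suc (j + M) + suc (t + M) C (j + M)
    ≡⟨ +-comm (suc (t + M) C suc (j + M)) _ ⟩
  suc (t + M) C (j + M) + suc (t + M) C suc (j + M)
    ≡⟨ pascal (suc (t + M)) (j + M) ⟨
  suc (suc t + M) C suc (j + M) ∎
  where open ≡-Reasoning

weighted-hockey-stick : ∀ t M j →
  ∑[ s < suc t ] (((toℕ s + M) C M) * (toℕ s C j)) ≡ ((j + M) C M) * (suc (t + M) C suc (j + M))
weighted-hockey-stick t M j = begin
  ∑[ s < suc t ] (((toℕ s + M) C M) * (toℕ s C j))
    ≡⟨ sum-cong-≗ {suc t} (λ s → sym (trinomial-revision (toℕ s) j M)) ⟩
  ∑[ s < suc t ] (((toℕ s + M) C (j + M)) * ((j + M) C M))
    ≡⟨ *-distribʳ-sum {suc t} ((j + M) C M) (λ s → (toℕ s + M) C (j + M)) ⟨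
  ∑[ s < suc t ] ((toℕ s + M) C (j + M)) * ((j + M) C M)
    ≡⟨ cong (_* ((j + M) C M)) (hockey-stick t j M) ⟩
  (suc (t + M) C suc (j + M)) * ((j + M) C M)
    ≡⟨ *-comm (suc (t + M) C suc (j + M)) _ ⟩
  ((j + M) C M) * (suc (t + M) C suc (j + M)) ∎
  where open ≡-Reasoning

-- The source of the factor (n − k)/(n − k + j) of the formula, where n − k = suc M.
weighted-hockey-stick-scaled : ∀ t M j →
  (suc M + j) * ∑[ s < suc t ] (((toℕ s + M) C M) * (toℕ s C j)) ≡ suc M * (((t + suc M) C suc M) * (t C j))
weighted-hockey-stick-scaled t M j = begin
  (suc M + j) * ∑[ s < suc t ] (((toℕ s + M) C M) * (toℕ s C j))
    ≡⟨ cong₂ _*_ (cong suc (+-comm M j)) (weighted-hockey-stick t M j) ⟩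
  suc (j + M) * (((j + M) C M) * Y)
    ≡⟨ *-assoc (suc (j + M)) ((j + M) C M) Y ⟨
  (suc (j + M) * ((j + M) C M)) * Y
    ≡⟨ cong (_* Y) (absorption (j + M) M) ⟨
  (suc M * (suc (j + M) C suc M)) * Y
    ≡⟨ [xy]z≡x[zy] (suc M) (suc (j + M) C suc M) Y ⟩
  suc M * (Y * (suc (j + M) C suc M))
    ≡⟨ cong (suc M *_) (cong₂ (λ a b → (a C b) * (b C suc M)) (+-suc t M) (+-suc j M)) ⟨
  suc M * (((t + suc M) C (j + suc M)) * ((j + suc M) C suc M))
    ≡⟨ cong (suc M *_) (trinomial-revision t j (suc M)) ⟩
  suc M * (((t + suc M) C suc M) * (t C j)) ∎
  where
  open ≡-Reasoning
  Y = suc (t + M) C suc (j + M)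
  [xy]z≡x[zy] : ∀ x y z → (x * y) * z ≡ x * (z * y)
  [xy]z≡x[zy] = solve-∀

∑-product-binomials : ∀ t K M →
  ∑[ s < suc t ] (((toℕ s + K) C K) * ((toℕ s + M) C M)) ≡
  ∑[ j < suc K ] ((K C toℕ j) * ∑[ s < suc t ] (((toℕ s + M) C M) * (toℕ s C toℕ j)))
∑-product-binomials t K M = begin
  ∑[ s < suc t ] (((toℕ s + K) C K) * ((toℕ s + M) C M))
    ≡⟨ sum-cong-≗ {suc t} (λ s → cong (_* ((toℕ s + M) C M)) (binomial-as-∑ (toℕ s) K)) ⟩
  ∑[ s < suc t ] (∑[ j < suc K ] ((K C toℕ j) * (toℕ s C toℕ j)) * ((toℕ s + M) C M))
    ≡⟨ sum-cong-≗ {suc t} (λ s → *-distribʳ-sum {suc K} ((toℕ s + M) C M) (λ j → (K C toℕ j) * (toℕ s C toℕ j))) ⟩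
  ∑[ s < suc t ] ∑[ j < suc K ] ((K C toℕ j) * (toℕ s C toℕ j) * ((toℕ s + M) C M))
    ≡⟨ ∑-comm {suc t} {suc K} (λ s j → (K C toℕ j) * (toℕ s C toℕ j) * ((toℕ s + M) C M)) ⟩
  ∑[ j < suc K ] ∑[ s < suc t ] ((K C toℕ j) * (toℕ s C toℕ j) * ((toℕ s + M) C M))
    ≡⟨ sum-cong-≗ {suc K} (λ j → sum-cong-≗ {suc t} (λ s → xyz≡x[zy] (K C toℕ j) (toℕ s C toℕ j) ((toℕ s + M) C M))) ⟩
  ∑[ j < suc K ] ∑[ s < suc t ] ((K C toℕ j) * (((toℕ s + M) C M) * (toℕ s C toℕ j)))
    ≡⟨ sum-cong-≗ {suc K} (λ j → *-distribˡ-sum {suc t} (K C toℕ j) (λ s → ((toℕ s + M) C M) * (toℕ s C toℕ j))) ⟨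
  ∑[ j < suc K ] ((K C toℕ j) * ∑[ s < suc t ] (((toℕ s + M) C M) * (toℕ s C toℕ j))) ∎
  where
  open ≡-Reasoning
  xyz≡x[zy] : ∀ x y z → x * y * z ≡ x * (z * y)
  xyz≡x[zy] = solve-∀

toℚᵘ-ℤtoℚ : ∀ z → toℚᵘ (ℤtoℚ z) ℚᵘ.≃ mkℚᵘ z 0
toℚᵘ-ℤtoℚ z = ℚP.toℚᵘ-fromℚᵘ (mkℚᵘ z 0)

ℤtoℚ-+ : ∀ a b → ℤtoℚ (a ℤ.+ b) ≡ ℤtoℚ a ℚ.+ ℤtoℚ b
ℤtoℚ-+ a b = ℚP.toℚᵘ-injective (begin
  toℚᵘ (ℤtoℚ (a ℤ.+ b))                 ≈⟨ toℚᵘ-ℤtoℚ (a ℤ.+ b) ⟩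
  mkℚᵘ (a ℤ.+ b) 0                      ≈⟨ *≡* (cong (ℤ._* ℤ.+ 1) (sym (cong₂ ℤ._+_ (ℤP.*-identityʳ a) (ℤP.*-identityʳ b)))) ⟩
  mkℚᵘ a 0 ℚᵘ.+ mkℚᵘ b 0                ≈⟨ ℚᵘP.+-cong (toℚᵘ-ℤtoℚ a) (toℚᵘ-ℤtoℚ b) ⟨
  toℚᵘ (ℤtoℚ a) ℚᵘ.+ toℚᵘ (ℤtoℚ b)      ≈⟨ ℚP.toℚᵘ-homo-+ (ℤtoℚ a) (ℤtoℚ b) ⟨
  toℚᵘ (ℤtoℚ a ℚ.+ ℤtoℚ b)              ∎)
  where open ℚᵘP.≃-Reasoning

ℤtoℚ-* : ∀ a b → ℤtoℚ (a ℤ.* b) ≡ ℤtoℚ a ℚ.* ℤtoℚ b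
ℤtoℚ-* a b = ℚP.toℚᵘ-injective (begin
  toℚᵘ (ℤtoℚ (a ℤ.* b))                 ≈⟨ toℚᵘ-ℤtoℚ (a ℤ.* b) ⟩
  mkℚᵘ (a ℤ.* b) 0                      ≡⟨⟩
  mkℚᵘ a 0 ℚᵘ.* mkℚᵘ b 0                ≈⟨ ℚᵘP.*-cong (toℚᵘ-ℤtoℚ a) (toℚᵘ-ℤtoℚ b) ⟨
  toℚᵘ (ℤtoℚ a) ℚᵘ.* toℚᵘ (ℤtoℚ b)      ≈⟨ ℚP.toℚᵘ-homo-* (ℤtoℚ a) (ℤtoℚ b) ⟨
  toℚᵘ (ℤtoℚ a ℚ.* ℤtoℚ b)              ∎)
  where open ℚᵘP.≃-Reasoning

ℤtoℚ-cancel-≤ : ∀ {a b} → ℤtoℚ a ℚ.≤ ℤtoℚ b → a ℤ.≤ b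
ℤtoℚ-cancel-≤ {a} {b} a≤b
  with ℚᵘP.≤-respʳ-≃ (toℚᵘ-ℤtoℚ b) (ℚᵘP.≤-respˡ-≃ (toℚᵘ-ℤtoℚ a) (ℚP.toℚᵘ-mono-≤ a≤b))
... | *≤* a*1≤b*1 = subst₂ ℤ._≤_ (ℤP.*-identityʳ a) (ℤP.*-identityʳ b) a*1≤b*1

ℤtoℚ-mono-≤ : ∀ {a b} → a ℤ.≤ b → ℤtoℚ a ℚ.≤ ℤtoℚ b
ℤtoℚ-mono-≤ {a} {b} a≤b = ℚP.toℚᵘ-cancel-≤
  (ℚᵘP.≤-respʳ-≃ (ℚᵘP.≃-sym (toℚᵘ-ℤtoℚ b)) (ℚᵘP.≤-respˡ-≃ (ℚᵘP.≃-sym (toℚᵘ-ℤtoℚ a))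
    (*≤* (subst₂ ℤ._≤_ (sym (ℤP.*-identityʳ a)) (sym (ℤP.*-identityʳ b)) a≤b))))

ℤtoℚ-injective : ∀ {a b} → ℤtoℚ a ≡ ℤtoℚ b → a ≡ b
ℤtoℚ-injective a≡b = ℤP.≤-antisym (ℤtoℚ-cancel-≤ (ℚP.≤-reflexive a≡b)) (ℤtoℚ-cancel-≤ (ℚP.≤-reflexive (sym a≡b)))

ℕtoℚ-+ : ∀ a b → ℕtoℚ (a + b) ≡ ℕtoℚ a ℚ.+ ℕtoℚ b
ℕtoℚ-+ a b = ℤtoℚ-+ (ℤ.+ a) (ℤ.+ b)

ℕtoℚ-* : ∀ a b → ℕtoℚ (a * b) ≡ ℕtoℚ a ℚ.* ℕtoℚ b
ℕtoℚ-* a b = trans (cong ℤtoℚ (ℤP.pos-* a b)) (ℤtoℚ-* (ℤ.+ a) (ℤ.+ b))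

ℕtoℚ-injective : ∀ {a b} → ℕtoℚ a ≡ ℕtoℚ b → a ≡ b
ℕtoℚ-injective a≡b = ℤP.+-injective (ℤtoℚ-injective a≡b)

ℕtoℚ-cancel-≤ : ∀ {a b} → ℕtoℚ a ℚ.≤ ℕtoℚ b → a ≤ b
ℕtoℚ-cancel-≤ a≤b = ℤP.drop‿+≤+ (ℤtoℚ-cancel-≤ a≤b)

ℕtoℚ-mono-≤ : ∀ {a b} → a ≤ b → ℕtoℚ a ℚ.≤ ℕtoℚ b
ℕtoℚ-mono-≤ a≤b = ℤtoℚ-mono-≤ (ℤ.+≤+ a≤b)

ℕtoℚ-sum : ∀ n (f : Fin n → ℕ) → ℕtoℚ (sum f) ≡ ℚΣ.sum (ℕtoℚ ∘ f)
ℕtoℚ-sum zero    f = refl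
ℕtoℚ-sum (suc n) f = trans (ℕtoℚ-+ (f Fin.zero) _) (cong (ℕtoℚ (f Fin.zero) ℚ.+_) (ℕtoℚ-sum n (f ∘ Fin.suc)))

ℕtoℚ-≡-ratio-* : ∀ a b x y → suc b * x ≡ a * y → ℕtoℚ x ≡ ratio a (suc b) ℚ.* ℕtoℚ y
ℕtoℚ-≡-ratio-* a b x y [1+b]x≡ay = ℚP.toℚᵘ-injective toℚᵘ-≃
  where
  cross-multiplied : ℤ.+ x ℤ.* ℤ.+ (suc b * 1) ≡ (ℤ.+ a ℤ.* ℤ.+ y) ℤ.* ℤ.+ 1
  cross-multiplied = begin
    ℤ.+ x ℤ.* ℤ.+ (suc b * 1)   ≡⟨ ℤP.pos-* x (suc b * 1) ⟨
    ℤ.+ (x * (suc b * 1))       ≡⟨ cong (λ d → ℤ.+ (x * d)) (*-identityʳ (suc b)) ⟩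
    ℤ.+ (x * suc b)             ≡⟨ cong ℤ.+_ (trans (*-comm x (suc b)) [1+b]x≡ay) ⟩
    ℤ.+ (a * y)                 ≡⟨ ℤP.pos-* a y ⟩
    ℤ.+ a ℤ.* ℤ.+ y             ≡⟨ ℤP.*-identityʳ _ ⟨
    (ℤ.+ a ℤ.* ℤ.+ y) ℤ.* ℤ.+ 1 ∎
    where open ≡-Reasoning
  toℚᵘ-≃ : toℚᵘ (ℕtoℚ x) ℚᵘ.≃ toℚᵘ (ratio a (suc b) ℚ.* ℕtoℚ y)
  toℚᵘ-≃ = begin
    toℚᵘ (ℕtoℚ x)                             ≈⟨ toℚᵘ-ℤtoℚ (ℤ.+ x) ⟩
    mkℚᵘ (ℤ.+ x) 0                            ≈⟨ *≡* cross-multiplied ⟩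
    mkℚᵘ (ℤ.+ a) b ℚᵘ.* mkℚᵘ (ℤ.+ y) 0        ≈⟨ ℚᵘP.*-cong (ℚP.toℚᵘ-fromℚᵘ (mkℚᵘ (ℤ.+ a) b)) (toℚᵘ-ℤtoℚ (ℤ.+ y)) ⟨
    toℚᵘ (ratio a (suc b)) ℚᵘ.* toℚᵘ (ℕtoℚ y) ≈⟨ ℚP.toℚᵘ-homo-* (ratio a (suc b)) (ℕtoℚ y) ⟨
    toℚᵘ (ratio a (suc b) ℚ.* ℕtoℚ y)         ∎
    where open ℚᵘP.≃-Reasoning

sumℚ-map-applyUpTo : ∀ n (f : ℕ → ℕ) (g : ℕ → ℚ) → sumℚ (map g (applyUpTo f n)) ≡ ℚΣ.sum {n} (λ i → g (f (toℕ i)))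
sumℚ-map-applyUpTo zero    f g = refl
sumℚ-map-applyUpTo (suc n) f g = cong (g (f 0) ℚ.+_) (sumℚ-map-applyUpTo n (f ∘ suc) g)

-- Bases of T_{k,n}

<ᵇ≡true : ∀ {a b} → a < b → (a <ᵇ b) ≡ true
<ᵇ≡true a<b = Equivalence.to T-≡ (<⇒<ᵇ a<b)

<ᵇ≡false : ∀ {a b} → b ≤ a → (a <ᵇ b) ≡ false
<ᵇ≡false {a} {b} b≤a = ¬-not (λ a<ᵇb → ≤⇒≯ b≤a (<ᵇ⇒< a b (Equivalence.from T-≡ a<ᵇb)))

data ↑-View (k : ℕ) {m : ℕ} : Fin (k + m) → Set where
  path     : (j : Fin k) → ↑-View k (j ↑ˡ m)
  parallel : (p : Fin m) → ↑-View k (k ↑ʳ p)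

↑-view : ∀ k {m} (e : Fin (k + m)) → ↑-View k e
↑-view zero        e           = parallel e
↑-view (suc k)     Fin.zero    = path Fin.zero
↑-view (suc k) {m} (Fin.suc e) with ↑-view k {m} e
... | path j     = path (Fin.suc j)
... | parallel p = parallel p

module _ {k m : ℕ} where

  endA-path : (j : Fin k) → endA k (k + m) (j ↑ˡ m) ≡ toℕ j
  endA-path j rewrite toℕ-↑ˡ j m | <ᵇ≡true (toℕ<n j) = refl

  endB-path : (j : Fin k) → endB k (k + m) (j ↑ˡ m) ≡ suc (toℕ j)
  endB-path j rewrite toℕ-↑ˡ j m | <ᵇ≡true (toℕ<n j) = refl

  endA-parallel : (p : Fin m) → endA k (k + m) (k ↑ʳ p) ≡ k
  endA-parallel p rewrite toℕ-↑ʳ k p | <ᵇ≡false {k + toℕ p} (m≤m+n k (toℕ p)) = refl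

  endB-parallel : (p : Fin m) → endB k (k + m) (k ↑ʳ p) ≡ 0
  endB-parallel p rewrite toℕ-↑ʳ k p | <ᵇ≡false {k + toℕ p} (m≤m+n k (toℕ p)) = refl

Joins : ∀ k {n} → Fin n → ℕ → ℕ → Set
Joins k {n} e u v = (endA k n e ≡ u × endB k n e ≡ v) ⊎ (endB k n e ≡ u × endA k n e ≡ v)

Joins-sym : ∀ {k n} {e : Fin n} {u v} → Joins k e u v → Joins k e v u
Joins-sym (inj₁ (a , b)) = inj₂ (b , a)
Joins-sym (inj₂ (b , a)) = inj₁ (a , b)

module _ {k n : ℕ} {F : Vec Bool n} where

  Reach-trans : ∀ {u v w} → Reach k n F u v → Reach k n F v w → Reach k n F u w
  Reach-trans here                  r = r
  Reach-trans (step e e∈F joins r₁) r = step e e∈F joins (Reach-trans r₁ r)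

  Reach-snoc : ∀ {u v w} (e : Fin n) → lookup F e ≡ true → Joins k e v w → Reach k n F u v → Reach k n F u w
  Reach-snoc e e∈F joins r = Reach-trans r (step e e∈F joins here)

  Reach-sym : ∀ {u v} → Reach k n F u v → Reach k n F v u
  Reach-sym here                  = here
  Reach-sym (step e e∈F joins r) = Reach-snoc e e∈F (Joins-sym {k} joins) (Reach-sym r)

module _ {k m : ℕ} {F : Vec Bool (k + m)} where

  PathEdgesIn : ℕ → ℕ → Set
  PathEdgesIn a b = ∀ (j : Fin k) → a ≤ toℕ j → toℕ j < b → lookup F (j ↑ˡ m) ≡ true

  Reach-along-path : ∀ a d → a + d ≤ k → PathEdgesIn a (a + d) → Reach k (k + m) F a (a + d)
  Reach-along-path a zero    _       _       = subst (Reach k (k + m) F a) (sym (+-identityʳ a)) here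
  Reach-along-path a (suc d) a+1+d≤k present =
    subst (Reach k (k + m) F a) (sym (+-suc a d))
      (Reach-snoc (j ↑ˡ m) (present j a≤j j<a+1+d)
        (inj₁ (trans (endA-path j) toℕj≡a+d , trans (endB-path j) (cong suc toℕj≡a+d)))
        (Reach-along-path a d (<⇒≤ a+d<k) (λ i a≤i i<a+d → present i a≤i (<-≤-trans i<a+d (+-monoʳ-≤ a (n≤1+n d))))))
    where
    a+d<k : a + d < k
    a+d<k = subst (_≤ k) (+-suc a d) a+1+d≤k
    j = fromℕ< a+d<k
    toℕj≡a+d : toℕ j ≡ a + d
    toℕj≡a+d = toℕ-fromℕ< a+d<k
    a≤j : a ≤ toℕ j
    a≤j = subst (a ≤_) (sym toℕj≡a+d) (m≤m+n a d)
    j<a+1+d : toℕ j < a + suc d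
    j<a+1+d = subst₂ _<_ (sym toℕj≡a+d) (sym (+-suc a d)) (n<1+n (a + d))

bit : Bool → ℕ
bit b = if b then 1 else 0

card-++ : ∀ {r s} (xs : Vec Bool r) (ys : Vec Bool s) → card (xs ++ ys) ≡ card xs + card ys
card-++ []       ys = refl
card-++ (x ∷ xs) ys = trans (cong (bit x +_) (card-++ xs ys)) (sym (+-assoc (bit x) (card xs) (card ys)))

card-replicate : ∀ r b → card (replicate r b) ≡ r * bit b
card-replicate zero    b = refl
card-replicate (suc r) b = cong (bit b +_) (card-replicate r b)

card-[]≔ : ∀ {r} (xs : Vec Bool r) i b → card (xs [ i ]≔ b) + bit (lookup xs i) ≡ card xs + bit b
card-[]≔ (x ∷ xs) Fin.zero    b = x+y+z≡z+y+x (bit b) (card xs) (bit x)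
  where
  x+y+z≡z+y+x : ∀ x y z → x + y + z ≡ z + y + x
  x+y+z≡z+y+x = solve-∀
card-[]≔ (x ∷ xs) (Fin.suc i) b = begin
  bit x + card (xs [ i ]≔ b) + bit (lookup xs i) ≡⟨ +-assoc (bit x) _ _ ⟩
  bit x + (card (xs [ i ]≔ b) + bit (lookup xs i)) ≡⟨ cong (bit x +_) (card-[]≔ xs i b) ⟩
  bit x + (card xs + bit b)                        ≡⟨ +-assoc (bit x) _ _ ⟨
  bit x + card xs + bit b                          ∎
  where open ≡-Reasoning

pathBasis : ∀ k m → Vec Bool (k + m)
pathBasis k m = replicate k true ++ replicate m false

exchangeBasis : ∀ {k m} → Fin k → Fin m → Vec Bool (k + m)
exchangeBasis {k} {m} i p = (replicate k true [ i ]≔ false) ++ (replicate m false [ p ]≔ true)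

module _ {k m : ℕ} where

  pathBasis-path : ∀ j → lookup (pathBasis k m) (j ↑ˡ m) ≡ true
  pathBasis-path j = trans (Vecₚ.lookup-++ˡ (replicate k true) (replicate m false) j) (Vecₚ.lookup-replicate j true)

  pathBasis-parallel : ∀ q → lookup (pathBasis k m) (k ↑ʳ q) ≡ false
  pathBasis-parallel q = trans (Vecₚ.lookup-++ʳ (replicate k true) (replicate m false) q) (Vecₚ.lookup-replicate q false)

  exchangeBasis-path : ∀ {i} (p : Fin m) j → j ≢ i → lookup (exchangeBasis i p) (j ↑ˡ m) ≡ true
  exchangeBasis-path {i} p j j≢i = trans (Vecₚ.lookup-++ˡ (replicate k true [ i ]≔ false) _ j)
    (trans (Vecₚ.lookup∘update′ j≢i (replicate k true) false) (Vecₚ.lookup-replicate j true))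

  exchangeBasis-removed : ∀ i (p : Fin m) → lookup (exchangeBasis i p) (i ↑ˡ m) ≡ false
  exchangeBasis-removed i p = trans (Vecₚ.lookup-++ˡ (replicate k true [ i ]≔ false) _ i) (Vecₚ.lookup∘update i (replicate k true) false)

  exchangeBasis-parallel : ∀ (i : Fin k) {p} q → q ≢ p → lookup (exchangeBasis i p) (k ↑ʳ q) ≡ false
  exchangeBasis-parallel i {p} q q≢p = trans (Vecₚ.lookup-++ʳ (replicate k true [ i ]≔ false) _ q)
    (trans (Vecₚ.lookup∘update′ q≢p (replicate m false) true) (Vecₚ.lookup-replicate q false))

  exchangeBasis-added : ∀ (i : Fin k) p → lookup (exchangeBasis i p) (k ↑ʳ p) ≡ true
  exchangeBasis-added i p = trans (Vecₚ.lookup-++ʳ (replicate k true [ i ]≔ false) _ p) (Vecₚ.lookup∘update p (replicate m false) true)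

  pathBasis-isBasis : IsBasisT k (k + m) (pathBasis k m)
  pathBasis-isBasis = card-pathBasis , λ v v≤k → Reach-along-path 0 v v≤k (λ j _ _ → pathBasis-path j)
    where
    card-pathBasis : card (pathBasis k m) ≡ k
    card-pathBasis = begin
      card (replicate k true ++ replicate m false)            ≡⟨ card-++ (replicate k true) (replicate m false) ⟩
      card (replicate k true) + card (replicate m false)      ≡⟨ cong₂ _+_ (card-replicate k true) (card-replicate m false) ⟩
      k * 1 + m * 0                                       ≡⟨ cong₂ _+_ (*-identityʳ k) (*-zeroʳ m) ⟩
      k + 0                                                   ≡⟨ +-identityʳ k ⟩
      k                                                       ∎
      where open ≡-Reasoning

  exchangeBasis-isBasis : ∀ i p → IsBasisT k (k + m) (exchangeBasis i p)
  exchangeBasis-isBasis i p = card-exchangeBasis , reach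
    where
    path′ = replicate k true [ i ]≔ false
    parallel′ = replicate m false [ p ]≔ true
    card-path′ : card path′ + 1 ≡ k
    card-path′ = begin
      card path′ + 1                                 ≡⟨ cong (λ b → card path′ + bit b) (Vecₚ.lookup-replicate i true) ⟨
      card path′ + bit (lookup (replicate k true) i) ≡⟨ card-[]≔ (replicate k true) i false ⟩
      card (replicate k true) + 0                    ≡⟨ +-identityʳ _ ⟩
      card (replicate k true)                        ≡⟨ card-replicate k true ⟩
      k * 1                                        ≡⟨ *-identityʳ k ⟩
      k                                              ∎
      where open ≡-Reasoning
    card-parallel′ : card parallel′ ≡ 1
    card-parallel′ = begin
      card parallel′                                      ≡⟨ +-identityʳ _ ⟨
      card parallel′ + 0                                  ≡⟨ cong (λ b → card parallel′ + bit b) (Vecₚ.lookup-replicate p false) ⟨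
      card parallel′ + bit (lookup (replicate m false) p) ≡⟨ card-[]≔ (replicate m false) p true ⟩
      card (replicate m false) + 1                        ≡⟨ cong (_+ 1) (trans (card-replicate m false) (*-zeroʳ m)) ⟩
      1                                                   ∎
      where open ≡-Reasoning
    card-exchangeBasis : card (exchangeBasis i p) ≡ k
    card-exchangeBasis = trans (card-++ path′ parallel′) (trans (cong (card path′ +_) card-parallel′) card-path′)
    reach : ∀ v → v ≤ k → Reach k (k + m) (exchangeBasis i p) 0 v
    reach v v≤k with v ≤? toℕ i
    ... | yes v≤i = Reach-along-path 0 v v≤k
          (λ j _ j<v → exchangeBasis-path p j (λ { refl → <⇒≱ j<v v≤i }))
    ... | no v≰i = Reach-trans
          (step (k ↑ʳ p) (exchangeBasis-added i p) (inj₂ (endB-parallel p , endA-parallel p)) here)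
          (Reach-sym (subst (Reach k (k + m) _ v) (m+[n∸m]≡n v≤k) (Reach-along-path v (k ∸ v) (≤-reflexive (m+[n∸m]≡n v≤k))
            (λ j v≤j _ → exchangeBasis-path p j (λ { refl → v≰i v≤j })))))

card<⇒∃false : ∀ {r} (a : Vec Bool r) → card a < r → Σ (Fin r) λ i → lookup a i ≡ false
card<⇒∃false (false ∷ a) _           = Fin.zero , refl
card<⇒∃false (true ∷ a)  (s≤s card<r) with card<⇒∃false a card<r
... | i , a[i]≡false = Fin.suc i , a[i]≡false

card+2≤⇒∃two-false : ∀ {r} (a : Vec Bool r) → 2 + card a ≤ r →
  Σ (Fin r) λ i₁ → Σ (Fin r) λ i₂ → toℕ i₁ < toℕ i₂ × lookup a i₁ ≡ false × lookup a i₂ ≡ false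
card+2≤⇒∃two-false (false ∷ a) (s≤s card<r) with card<⇒∃false a card<r
... | i , a[i]≡false = Fin.zero , Fin.suc i , s≤s z≤n , refl , a[i]≡false
card+2≤⇒∃two-false (true ∷ a)  (s≤s card+2≤r) with card+2≤⇒∃two-false a card+2≤r
... | i₁ , i₂ , i₁<i₂ , a[i₁]≡false , a[i₂]≡false = Fin.suc i₁ , Fin.suc i₂ , s≤s i₁<i₂ , a[i₁]≡false , a[i₂]≡false

module _ {k m : ℕ} (a : Vec Bool k) (b : Vec Bool m) {i₁ i₂ : Fin k} (i₁<i₂ : toℕ i₁ < toℕ i₂)
         (a[i₁]≡false : lookup a i₁ ≡ false) (a[i₂]≡false : lookup a i₂ ≡ false) where

  private
    -- With path edges i₁ and i₂ missing, no edge leaves the vertices i₁ + 1, …, i₂: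
    -- parallel edges only join 0 and k.
    Cut : ℕ → Set
    Cut v = toℕ i₁ < v × v ≤ toℕ i₂

    present⇒≢ : ∀ {j i} → lookup a j ≡ true → lookup a i ≡ false → toℕ j ≢ toℕ i
    present⇒≢ a[j]≡true a[i]≡false j≡i with toℕ-injective j≡i
    ... | refl with trans (sym a[j]≡true) a[i]≡false
    ...   | ()

    ¬Cut-suc : ∀ x → x ≢ toℕ i₁ → ¬ Cut x → ¬ Cut (suc x)
    ¬Cut-suc x x≢i₁ ¬cut (i₁<1+x , 1+x≤i₂) =
      ¬cut (≤∧≢⇒< (≤-pred i₁<1+x) (x≢i₁ ∘ sym) , ≤-trans (n≤1+n x) 1+x≤i₂)

    ¬Cut-pred : ∀ x → x ≢ toℕ i₂ → ¬ Cut (suc x) → ¬ Cut x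
    ¬Cut-pred x x≢i₂ ¬cut (i₁<x , x≤i₂) = ¬cut (≤-trans i₁<x (n≤1+n x) , ≤∧≢⇒< x≤i₂ x≢i₂)

    ¬Cut-0 : ¬ Cut 0
    ¬Cut-0 ()

    ¬Cut-k : ¬ Cut k
    ¬Cut-k (_ , k≤i₂) = <⇒≱ (toℕ<n i₂) k≤i₂

    ¬Cut-≡ : ∀ {x y} → x ≡ y → ¬ Cut x → ¬ Cut y
    ¬Cut-≡ refl ¬cut = ¬cut

    edge-preserves-¬Cut : ∀ {u v} e → lookup (a ++ b) e ≡ true → Joins k e u v → ¬ Cut u → ¬ Cut v
    edge-preserves-¬Cut e e∈F joins ¬cut with ↑-view k e
    ... | parallel p with joins
    ...   | inj₁ (_ , B≡v) = ¬Cut-≡ (trans (sym (endB-parallel p)) B≡v) ¬Cut-0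
    ...   | inj₂ (_ , A≡v) = ¬Cut-≡ (trans (sym (endA-parallel p)) A≡v) ¬Cut-k
    edge-preserves-¬Cut e e∈F joins ¬cut | path j with trans (sym (Vecₚ.lookup-++ˡ a b j)) e∈F | joins
    ... | a[j]≡true | inj₁ (A≡u , B≡v) = ¬Cut-≡ (trans (sym (endB-path j)) B≡v)
          (¬Cut-suc (toℕ j) (present⇒≢ a[j]≡true a[i₁]≡false) (¬Cut-≡ (trans (sym A≡u) (endA-path j)) ¬cut))
    ... | a[j]≡true | inj₂ (B≡u , A≡v) = ¬Cut-≡ (trans (sym (endA-path j)) A≡v)
          (¬Cut-pred (toℕ j) (present⇒≢ a[j]≡true a[i₂]≡false) (¬Cut-≡ (trans (sym B≡u) (endB-path j)) ¬cut))

    Reach-preserves-¬Cut : ∀ {u v} → Reach k (k + m) (a ++ b) u v → ¬ Cut u → ¬ Cut v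
    Reach-preserves-¬Cut here                   ¬cut = ¬cut
    Reach-preserves-¬Cut (step e e∈F joins r) ¬cut = Reach-preserves-¬Cut r (edge-preserves-¬Cut e e∈F joins ¬cut)

  two-missing-path-edges⇒¬isBasis : ¬ IsBasisT k (k + m) (a ++ b)
  two-missing-path-edges⇒¬isBasis (_ , reach) =
    Reach-preserves-¬Cut (reach (suc (toℕ i₁)) (≤-trans i₁<i₂ (<⇒≤ (toℕ<n i₂)))) ¬Cut-0 (≤-refl , i₁<i₂)

isBasis⇒card-parallel≤1 : ∀ {k m} (a : Vec Bool k) (b : Vec Bool m) → IsBasisT k (k + m) (a ++ b) → card b ≤ 1
isBasis⇒card-parallel≤1 {k} a b isBasis with card b ≤? 1
... | yes card-b≤1 = card-b≤1
... | no  card-b≰1 =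
  let i₁ , i₂ , i₁<i₂ , a[i₁]≡false , a[i₂]≡false = card+2≤⇒∃two-false a two-missing
  in contradiction isBasis (two-missing-path-edges⇒¬isBasis a b i₁<i₂ a[i₁]≡false a[i₂]≡false)
  where
  two-missing : 2 + card a ≤ k
  two-missing = begin
    2 + card a      ≡⟨ +-comm 2 (card a) ⟩
    card a + 2      ≤⟨ +-monoʳ-≤ (card a) (≰⇒> card-b≰1) ⟩
    card a + card b ≡⟨ card-++ a b ⟨
    card (a ++ b)   ≡⟨ proj₁ isBasis ⟩
    k               ∎
    where open ≤-Reasoning

-- Lattice points of t·P(T_{k,n})

module WeightedSum {A : Set} (Good : A → Set) where

  weightedSum : List (ℚ × A) → (A → ℚ) → ℚ
  weightedSum ws h = sumℚ (map (λ p → proj₁ p ℚ.* h (proj₂ p)) ws)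

  totalWeight : List (ℚ × A) → ℚ
  totalWeight ws = sumℚ (map proj₁ ws)

  NonNegGood : ℚ × A → Set
  NonNegGood (w , a) = 0ℚ ℚ.≤ w × Good a

  weightedSum-+ : ∀ ws h h′ → weightedSum ws (λ a → h a ℚ.+ h′ a) ≡ weightedSum ws h ℚ.+ weightedSum ws h′
  weightedSum-+ []             h h′ = refl
  weightedSum-+ ((w , a) ∷ ws) h h′ =
    trans (cong₂ ℚ._+_ (ℚP.*-distribˡ-+ w (h a) (h′ a)) (weightedSum-+ ws h h′))
          (interchange (w ℚ.* h a) (w ℚ.* h′ a) (weightedSum ws h) (weightedSum ws h′))
    where
    interchange : ∀ a b c d → (a ℚ.+ b) ℚ.+ (c ℚ.+ d) ≡ (a ℚ.+ c) ℚ.+ (b ℚ.+ d)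
    interchange = solve 4 (λ a b c d → (a :+ b) :+ (c :+ d) := (a :+ c) :+ (b :+ d)) refl
      where open +-*-Solver

  weightedSum-0 : ∀ ws → weightedSum ws (λ _ → 0ℚ) ≡ 0ℚ
  weightedSum-0 []             = refl
  weightedSum-0 ((w , a) ∷ ws) = trans (cong₂ ℚ._+_ (ℚP.*-zeroʳ w) (weightedSum-0 ws)) (ℚP.+-identityʳ 0ℚ)

  ∑-weightedSum : ∀ ws r (h : Fin r → A → ℚ) →
    ℚΣ.sum (λ c → weightedSum ws (h c)) ≡ weightedSum ws (λ a → ℚΣ.sum (λ c → h c a))
  ∑-weightedSum ws zero    h = sym (weightedSum-0 ws)
  ∑-weightedSum ws (suc r) h =
    trans (cong (weightedSum ws (h Fin.zero) ℚ.+_) (∑-weightedSum ws r (h ∘ Fin.suc)))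
          (sym (weightedSum-+ ws (h Fin.zero) _))

  weightedSum-const : ∀ ws h γ → All NonNegGood ws → (∀ a → Good a → h a ≡ γ) → weightedSum ws h ≡ γ ℚ.* totalWeight ws
  weightedSum-const []             h γ []             _     = sym (ℚP.*-zeroʳ γ)
  weightedSum-const ((w , a) ∷ ws) h γ ((_ , ga) ∷ gs) h≡γ = begin
    w ℚ.* h a ℚ.+ weightedSum ws h      ≡⟨ cong₂ ℚ._+_ (cong (w ℚ.*_) (h≡γ a ga)) (weightedSum-const ws h γ gs h≡γ) ⟩
    w ℚ.* γ ℚ.+ γ ℚ.* totalWeight ws    ≡⟨ cong (ℚ._+ γ ℚ.* totalWeight ws) (ℚP.*-comm w γ) ⟩
    γ ℚ.* w ℚ.+ γ ℚ.* totalWeight ws    ≡⟨ ℚP.*-distribˡ-+ γ w _ ⟨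
    γ ℚ.* (w ℚ.+ totalWeight ws)        ∎
    where open ≡-Reasoning

  weightedSum-≤ : ∀ ws h β → All NonNegGood ws → (∀ a → Good a → h a ℚ.≤ β) → weightedSum ws h ℚ.≤ β ℚ.* totalWeight ws
  weightedSum-≤ []             h β []               _    = ℚP.≤-reflexive (sym (ℚP.*-zeroʳ β))
  weightedSum-≤ ((w , a) ∷ ws) h β ((0≤w , ga) ∷ gs) h≤β = begin
    w ℚ.* h a ℚ.+ weightedSum ws h
      ≤⟨ ℚP.+-mono-≤ (ℚP.*-monoˡ-≤-nonNeg w {{ℚ.nonNegative 0≤w}} (h≤β a ga)) (weightedSum-≤ ws h β gs h≤β) ⟩
    w ℚ.* β ℚ.+ β ℚ.* totalWeight ws    ≡⟨ cong (ℚ._+ β ℚ.* totalWeight ws) (ℚP.*-comm w β) ⟩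
    β ℚ.* w ℚ.+ β ℚ.* totalWeight ws    ≡⟨ ℚP.*-distribˡ-+ β w _ ⟨
    β ℚ.* (w ℚ.+ totalWeight ws)        ∎
    where open ℚP.≤-Reasoning

  weightedSum-≥ : ∀ ws h α → All NonNegGood ws → (∀ a → Good a → α ℚ.≤ h a) → α ℚ.* totalWeight ws ℚ.≤ weightedSum ws h
  weightedSum-≥ []             h α []               _    = ℚP.≤-reflexive (ℚP.*-zeroʳ α)
  weightedSum-≥ ((w , a) ∷ ws) h α ((0≤w , ga) ∷ gs) α≤h = begin
    α ℚ.* (w ℚ.+ totalWeight ws)        ≡⟨ ℚP.*-distribˡ-+ α w _ ⟩
    α ℚ.* w ℚ.+ α ℚ.* totalWeight ws    ≡⟨ cong (ℚ._+ α ℚ.* totalWeight ws) (ℚP.*-comm α w) ⟩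
    w ℚ.* α ℚ.+ α ℚ.* totalWeight ws
      ≤⟨ ℚP.+-mono-≤ (ℚP.*-monoˡ-≤-nonNeg w {{ℚ.nonNegative 0≤w}} (α≤h a ga)) (weightedSum-≥ ws h α gs α≤h) ⟩
    w ℚ.* h a ℚ.+ weightedSum ws h      ∎
    where open ℚP.≤-Reasoning

complement : ℕ → ℕ → ℤ
complement t x = ℤ.+ t ℤ.- ℤ.+ x

complement-+ : ∀ m n → complement (m + n) n ≡ ℤ.+ m
complement-+ m n = trans (ℤP.m-n≡m⊖n (m + n) n) (trans (ℤP.⊖-≥ (m≤n+m n m)) (cong ℤ.+_ (m+n∸n≡m m n)))

complement-∸ : ∀ {t x} → x ≤ t → complement t (t ∸ x) ≡ ℤ.+ x
complement-∸ {t} {x} x≤t = trans (ℤP.m-n≡m⊖n t (t ∸ x)) (trans (ℤP.⊖-≥ (m∸n≤m t x)) (cong ℤ.+_ (m∸[m∸n]≡n x≤t)))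

complement-injective : ∀ t {x y} → complement t x ≡ complement t y → x ≡ y
complement-injective t eq = ℤP.+-injective (ℤP.neg-injective (∙-cancelˡ (ℤ.+ t) _ _ eq))

-- dᵢ counts the bases avoiding path edge i, and bₚ those containing parallel edge p.
point : ∀ {k m} → ℕ → Vec ℕ k → Vec ℕ m → Vec ℤ (k + m)
point t d b = Vec.map (complement t) d ++ Vec.map ℤ.+_ b

indicator≡bit : ∀ x → (if x then 1ℚ else 0ℚ) ≡ ℕtoℚ (bit x)
indicator≡bit true  = refl
indicator≡bit false = refl

indicator≤1 : ∀ {n} (B : Vec Bool n) c → indicator B c ℚ.≤ 1ℚ
indicator≤1 B c with lookup B c
... | true  = ℚP.≤-refl
... | false = ℕtoℚ-mono-≤ {0} {1} z≤n

indicator≥0 : ∀ {n} (B : Vec Bool n) c → 0ℚ ℚ.≤ indicator B c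
indicator≥0 B c with lookup B c
... | true  = ℕtoℚ-mono-≤ {0} {1} z≤n
... | false = ℚP.≤-refl

∑-indicator : ∀ {r} (v : Vec Bool r) → ℚΣ.sum (indicator v) ≡ ℕtoℚ (card v)
∑-indicator []      = refl
∑-indicator (x ∷ v) = trans (cong₂ ℚ._+_ (indicator≡bit x) (∑-indicator v)) (sym (ℕtoℚ-+ (bit x) (card v)))

∑-ℕtoℚ-lookup : ∀ {r} (v : Vec ℕ r) → ℚΣ.sum (ℕtoℚ ∘ lookup v) ≡ ℕtoℚ (Vec.sum v)
∑-ℕtoℚ-lookup []      = refl
∑-ℕtoℚ-lookup (x ∷ v) = trans (cong (ℕtoℚ x ℚ.+_) (∑-ℕtoℚ-lookup v)) (sym (ℕtoℚ-+ x (Vec.sum v)))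

map-+-∣∣ : ∀ {r} (z : Vec ℤ r) → (∀ c → 0ℤ ℤ.≤ lookup z c) → Vec.map ℤ.+_ (Vec.map ∣_∣ z) ≡ z
map-+-∣∣ []      _   = refl
map-+-∣∣ (x ∷ z) 0≤z = cong₂ _∷_ (ℤP.0≤i⇒+∣i∣≡i (0≤z Fin.zero)) (map-+-∣∣ z (0≤z ∘ Fin.suc))

map-+-complement : ∀ {r} t (w : Vec ℕ r) → (∀ i → lookup w i ≤ t) →
  Vec.map ℤ.+_ w ≡ Vec.map (complement t) (Vec.map (t ∸_) w)
map-+-complement t []      _   = refl
map-+-complement t (x ∷ w) w≤t = cong₂ _∷_ (sym (complement-∸ (w≤t Fin.zero))) (map-+-complement t w (w≤t ∘ Fin.suc))

sum-map-∸ : ∀ {r} t (w : Vec ℕ r) → (∀ i → lookup w i ≤ t) → Vec.sum (Vec.map (t ∸_) w) + Vec.sum w ≡ r * t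
sum-map-∸ t []      _   = refl
sum-map-∸ {suc r} t (x ∷ w) w≤t =
  trans (interchange (t ∸ x) (Vec.sum (Vec.map (t ∸_) w)) x (Vec.sum w))
        (cong₂ _+_ (m∸n+n≡m (w≤t Fin.zero)) (sum-map-∸ t w (w≤t ∘ Fin.suc)))
  where
  interchange : ∀ a b c d → a + b + (c + d) ≡ (a + c) + (b + d)
  interchange = solve-∀

module Degree (k m : ℕ) where

  pathDegree parallelDegree : Vec Bool (k + m) → ℚ
  pathDegree     B = ℚΣ.sum (λ i → indicator B (i ↑ˡ m))
  parallelDegree B = ℚΣ.sum (λ p → indicator B (k ↑ʳ p))

  pathDegree-++ : ∀ (a : Vec Bool k) (b : Vec Bool m) → pathDegree (a ++ b) ≡ ℕtoℚ (card a)
  pathDegree-++ a b =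
    trans (ℚΣ.sum-cong-≗ {k} (λ i → cong (λ x → if x then 1ℚ else 0ℚ) (Vecₚ.lookup-++ˡ a b i))) (∑-indicator a)

  parallelDegree-++ : ∀ (a : Vec Bool k) (b : Vec Bool m) → parallelDegree (a ++ b) ≡ ℕtoℚ (card b)
  parallelDegree-++ a b =
    trans (ℚΣ.sum-cong-≗ {m} (λ p → cong (λ x → if x then 1ℚ else 0ℚ) (Vecₚ.lookup-++ʳ a b p))) (∑-indicator b)

  isBasis⇒parallelDegree≤1 : ∀ B → IsBasisT k (k + m) B → parallelDegree B ℚ.≤ 1ℚ
  isBasis⇒parallelDegree≤1 B isBasis with Vec.splitAt k B
  ... | a , b , refl = ℚP.≤-trans (ℚP.≤-reflexive (parallelDegree-++ a b)) (ℕtoℚ-mono-≤ (isBasis⇒card-parallel≤1 a b isBasis))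

  isBasis⇒degree≡k : ∀ B → IsBasisT k (k + m) B → pathDegree B ℚ.+ parallelDegree B ≡ ℕtoℚ k
  isBasis⇒degree≡k B isBasis with Vec.splitAt k B
  ... | a , b , refl = begin
    pathDegree (a ++ b) ℚ.+ parallelDegree (a ++ b) ≡⟨ cong₂ ℚ._+_ (pathDegree-++ a b) (parallelDegree-++ a b) ⟩
    ℕtoℚ (card a) ℚ.+ ℕtoℚ (card b)                 ≡⟨ ℕtoℚ-+ (card a) (card b) ⟨
    ℕtoℚ (card a + card b)                          ≡⟨ cong ℕtoℚ (card-++ a b) ⟨
    ℕtoℚ (card (a ++ b))                            ≡⟨ cong ℕtoℚ (proj₁ isBasis) ⟩
    ℕtoℚ k                                          ∎
    where open ≡-Reasoning

module Necessity {k m : ℕ} (t : ℕ) (za : Vec ℤ k) (zb : Vec ℤ m) (lp : LatticePoint k (k + m) t (za ++ zb)) where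

  open WeightedSum (IsBasisT k (k + m))
  open Degree k m

  ws : List (ℚ × Vec Bool (k + m))
  ws = proj₁ lp

  good : All NonNegGood ws
  good = proj₁ (proj₂ lp)

  totalWeight≡1 : totalWeight ws ≡ 1ℚ
  totalWeight≡1 = proj₁ (proj₂ (proj₂ lp))

  z≡ : ∀ c → ℤtoℚ (lookup (za ++ zb) c) ≡ ℕtoℚ t ℚ.* weightedSum ws (λ B → indicator B c)
  z≡ = proj₂ (proj₂ (proj₂ lp))

  instance
    t-nonNeg : ℚ.NonNegative (ℕtoℚ t)
    t-nonNeg = ℚ.nonNegative (ℕtoℚ-mono-≤ {0} {t} z≤n)

  t*weightedSum≤t : ∀ h → (∀ B → IsBasisT k (k + m) B → h B ℚ.≤ 1ℚ) → ℕtoℚ t ℚ.* weightedSum ws h ℚ.≤ ℕtoℚ t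
  t*weightedSum≤t h h≤1 = begin
    ℕtoℚ t ℚ.* weightedSum ws h          ≤⟨ ℚP.*-monoˡ-≤-nonNeg (ℕtoℚ t) (weightedSum-≤ ws h 1ℚ good h≤1) ⟩
    ℕtoℚ t ℚ.* (1ℚ ℚ.* totalWeight ws)   ≡⟨ cong (λ w → ℕtoℚ t ℚ.* w) (trans (ℚP.*-identityˡ _) totalWeight≡1) ⟩
    ℕtoℚ t ℚ.* 1ℚ                        ≡⟨ ℚP.*-identityʳ (ℕtoℚ t) ⟩
    ℕtoℚ t                               ∎
    where open ℚP.≤-Reasoning

  0≤z : ∀ c → 0ℤ ℤ.≤ lookup (za ++ zb) c
  0≤z c = ℤtoℚ-cancel-≤ (begin
    0ℚ                                                ≡⟨ ℚP.*-zeroʳ (ℕtoℚ t) ⟨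
    ℕtoℚ t ℚ.* 0ℚ                                     ≡⟨ cong (ℕtoℚ t ℚ.*_) (ℚP.*-zeroˡ (totalWeight ws)) ⟨
    ℕtoℚ t ℚ.* (0ℚ ℚ.* totalWeight ws)                ≤⟨ ℚP.*-monoˡ-≤-nonNeg (ℕtoℚ t) (weightedSum-≥ ws _ 0ℚ good (λ B _ → indicator≥0 B c)) ⟩
    ℕtoℚ t ℚ.* weightedSum ws (λ B → indicator B c)   ≡⟨ z≡ c ⟨
    ℤtoℚ (lookup (za ++ zb) c)                        ∎)
    where open ℚP.≤-Reasoning

  z≤t : ∀ c → lookup (za ++ zb) c ℤ.≤ ℤ.+ t
  z≤t c = ℤtoℚ-cancel-≤ (subst (ℚ._≤ ℕtoℚ t) (sym (z≡ c)) (t*weightedSum≤t _ (λ B _ → indicator≤1 B c)))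

  ∑-coordinates : ∀ {r} (σ : Fin r → Fin (k + m)) (v : Vec ℕ r) → (∀ i → lookup (za ++ zb) (σ i) ≡ ℤ.+ lookup v i) →
    ℕtoℚ (Vec.sum v) ≡ ℕtoℚ t ℚ.* weightedSum ws (λ B → ℚΣ.sum (λ i → indicator B (σ i)))
  ∑-coordinates {r} σ v z∘σ≡v = begin
    ℕtoℚ (Vec.sum v)
      ≡⟨ ∑-ℕtoℚ-lookup v ⟨
    ℚΣ.sum (ℕtoℚ ∘ lookup v)
      ≡⟨ ℚΣ.sum-cong-≗ {r} (λ i → trans (cong ℤtoℚ (sym (z∘σ≡v i))) (z≡ (σ i))) ⟩
    ℚΣ.sum (λ i → ℕtoℚ t ℚ.* weightedSum ws (λ B → indicator B (σ i)))
      ≡⟨ ℚΣ.*-distribˡ-sum (ℕtoℚ t) (λ i → weightedSum ws (λ B → indicator B (σ i))) ⟨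
    ℕtoℚ t ℚ.* ℚΣ.sum (λ i → weightedSum ws (λ B → indicator B (σ i)))
      ≡⟨ cong (ℕtoℚ t ℚ.*_) (∑-weightedSum ws r (λ i B → indicator B (σ i))) ⟩
    ℕtoℚ t ℚ.* weightedSum ws (λ B → ℚΣ.sum (λ i → indicator B (σ i))) ∎
    where open ≡-Reasoning

  wa : Vec ℕ k
  wa = Vec.map ∣_∣ za

  wb : Vec ℕ m
  wb = Vec.map ∣_∣ zb

  map-+-wa : Vec.map ℤ.+_ wa ≡ za
  map-+-wa = map-+-∣∣ za (λ i → subst (0ℤ ℤ.≤_) (Vecₚ.lookup-++ˡ za zb i) (0≤z (i ↑ˡ m)))

  map-+-wb : Vec.map ℤ.+_ wb ≡ zb
  map-+-wb = map-+-∣∣ zb (λ p → subst (0ℤ ℤ.≤_) (Vecₚ.lookup-++ʳ za zb p) (0≤z (k ↑ʳ p)))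

  z-path : ∀ i → lookup (za ++ zb) (i ↑ˡ m) ≡ ℤ.+ lookup wa i
  z-path i = trans (Vecₚ.lookup-++ˡ za zb i) (trans (cong (λ v → lookup v i) (sym map-+-wa)) (Vecₚ.lookup-map i ℤ.+_ wa))

  z-parallel : ∀ p → lookup (za ++ zb) (k ↑ʳ p) ≡ ℤ.+ lookup wb p
  z-parallel p = trans (Vecₚ.lookup-++ʳ za zb p) (trans (cong (λ v → lookup v p) (sym map-+-wb)) (Vecₚ.lookup-map p ℤ.+_ wb))

  wa≤t : ∀ i → lookup wa i ≤ t
  wa≤t i = ℤP.drop‿+≤+ (subst (ℤ._≤ ℤ.+ t) (z-path i) (z≤t (i ↑ˡ m)))

  sum-wb≤t : Vec.sum wb ≤ t
  sum-wb≤t = ℕtoℚ-cancel-≤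
    (subst (ℚ._≤ ℕtoℚ t) (sym (∑-coordinates (k ↑ʳ_) wb z-parallel)) (t*weightedSum≤t parallelDegree isBasis⇒parallelDegree≤1))

  sum-wa+sum-wb : Vec.sum wa + Vec.sum wb ≡ k * t
  sum-wa+sum-wb = ℕtoℚ-injective (begin
    ℕtoℚ (Vec.sum wa + Vec.sum wb)
      ≡⟨ ℕtoℚ-+ (Vec.sum wa) (Vec.sum wb) ⟩
    ℕtoℚ (Vec.sum wa) ℚ.+ ℕtoℚ (Vec.sum wb)
      ≡⟨ cong₂ ℚ._+_ (∑-coordinates (_↑ˡ m) wa z-path) (∑-coordinates (k ↑ʳ_) wb z-parallel) ⟩
    ℕtoℚ t ℚ.* weightedSum ws pathDegree ℚ.+ ℕtoℚ t ℚ.* weightedSum ws parallelDegree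
      ≡⟨ ℚP.*-distribˡ-+ (ℕtoℚ t) _ _ ⟨
    ℕtoℚ t ℚ.* (weightedSum ws pathDegree ℚ.+ weightedSum ws parallelDegree)
      ≡⟨ cong (ℕtoℚ t ℚ.*_) (weightedSum-+ ws pathDegree parallelDegree) ⟨
    ℕtoℚ t ℚ.* weightedSum ws (λ B → pathDegree B ℚ.+ parallelDegree B)
      ≡⟨ cong (ℕtoℚ t ℚ.*_) (weightedSum-const ws (λ B → pathDegree B ℚ.+ parallelDegree B) (ℕtoℚ k) good isBasis⇒degree≡k) ⟩
    ℕtoℚ t ℚ.* (ℕtoℚ k ℚ.* totalWeight ws)
      ≡⟨ cong (λ w → ℕtoℚ t ℚ.* (ℕtoℚ k ℚ.* w)) totalWeight≡1 ⟩
    ℕtoℚ t ℚ.* (ℕtoℚ k ℚ.* 1ℚ)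
      ≡⟨ cong (ℕtoℚ t ℚ.*_) (ℚP.*-identityʳ (ℕtoℚ k)) ⟩
    ℕtoℚ t ℚ.* ℕtoℚ k
      ≡⟨ ℚP.*-comm (ℕtoℚ t) (ℕtoℚ k) ⟩
    ℕtoℚ k ℚ.* ℕtoℚ t
      ≡⟨ ℕtoℚ-* k t ⟨
    ℕtoℚ (k * t) ∎)
    where open ≡-Reasoning

  representation : Σ (Vec ℕ k) λ d → Σ (Vec ℕ m) λ b → Vec.sum d ≡ Vec.sum b × Vec.sum b ≤ t × za ++ zb ≡ point t d b
  representation =
    Vec.map (t ∸_) wa , wb , sum-d≡sum-wb , sum-wb≤t ,
    cong₂ _++_ (trans (sym map-+-wa) (map-+-complement t wa wa≤t)) (sym map-+-wb)
    where
    sum-d≡sum-wb : Vec.sum (Vec.map (t ∸_) wa) ≡ Vec.sum wb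
    sum-d≡sum-wb = +-cancelʳ-≡ (Vec.sum wa) _ _
      (trans (sum-map-∸ t wa wa≤t) (trans (sym sum-wa+sum-wb) (+-comm (Vec.sum wa) (Vec.sum wb))))

LatticePoint⇒point : ∀ {k m} t (z : Vec ℤ (k + m)) → LatticePoint k (k + m) t z →
  Σ (Vec ℕ k) λ d → Σ (Vec ℕ m) λ b → Vec.sum d ≡ Vec.sum b × Vec.sum b ≤ t × z ≡ point t d b
LatticePoint⇒point {k} t z lp with Vec.splitAt k z
... | za , zb , refl = Necessity.representation t za zb lp

-- Greedy decomposition into bases

sum≡0⇒lookup≡0 : ∀ {r} (v : Vec ℕ r) → Vec.sum v ≡ 0 → ∀ i → lookup v i ≡ 0
sum≡0⇒lookup≡0 (x ∷ v) sum≡0 Fin.zero    = m+n≡0⇒m≡0 x sum≡0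
sum≡0⇒lookup≡0 (x ∷ v) sum≡0 (Fin.suc i) = sum≡0⇒lookup≡0 v (m+n≡0⇒n≡0 x sum≡0) i

sum≡suc⇒∃lookup≡suc : ∀ {r} (v : Vec ℕ r) {s} → Vec.sum v ≡ suc s → Σ (Fin r) λ i → Σ ℕ λ x → lookup v i ≡ suc x
sum≡suc⇒∃lookup≡suc (zero  ∷ v) sum≡1+s with sum≡suc⇒∃lookup≡suc v sum≡1+s
... | i , x , v[i]≡1+x = Fin.suc i , x , v[i]≡1+x
sum≡suc⇒∃lookup≡suc (suc y ∷ v) _ = Fin.zero , y , refl

sum-[]≔-pred : ∀ {r} (v : Vec ℕ r) i x → lookup v i ≡ suc x → Vec.sum v ≡ suc (Vec.sum (v [ i ]≔ x))
sum-[]≔-pred (y ∷ v) Fin.zero    x v[i]≡1+x = cong (_+ Vec.sum v) v[i]≡1+x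
sum-[]≔-pred (y ∷ v) (Fin.suc i) x v[i]≡1+x = trans (cong (y +_) (sum-[]≔-pred v i x v[i]≡1+x)) (+-suc y _)

multiplicity : ∀ {n} → List (Vec Bool n) → Fin n → ℕ
multiplicity []       c = 0
multiplicity (B ∷ Bs) c = bit (lookup B c) + multiplicity Bs c

record Decomposition {k m : ℕ} (t : ℕ) (d : Vec ℕ k) (b : Vec ℕ m) : Set where
  field
    bases                 : List (Vec Bool (k + m))
    all-bases             : All (IsBasisT k (k + m)) bases
    length-bases          : length bases ≡ t
    path-multiplicity     : ∀ i → multiplicity bases (i ↑ˡ m) + lookup d i ≡ t
    parallel-multiplicity : ∀ p → multiplicity bases (k ↑ʳ p) ≡ lookup b p

count-step : ∀ e {c v w t} → e + v ≡ suc w → c + w ≡ t → e + c + v ≡ suc t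
count-step e {c} {v} {w} {t} e+v≡1+w c+w≡t = begin
  e + c + v   ≡⟨ cong (_+ v) (+-comm e c) ⟩
  c + e + v   ≡⟨ +-assoc c e v ⟩
  c + (e + v) ≡⟨ cong (c +_) e+v≡1+w ⟩
  c + suc w   ≡⟨ +-suc c w ⟩
  suc (c + w) ≡⟨ cong suc c+w≡t ⟩
  suc t       ∎
  where open ≡-Reasoning

module _ {k m : ℕ} where

  exchangeBasis-path-bit : ∀ {d : Vec ℕ k} {i x} (p : Fin m) → lookup d i ≡ suc x → ∀ j →
    bit (lookup (exchangeBasis i p) (j ↑ˡ m)) + lookup d j ≡ suc (lookup (d [ i ]≔ x) j)
  exchangeBasis-path-bit {d} {i} {x} p d[i]≡1+x j with j Finₚ.≟ i
  ... | yes refl = trans (cong₂ (λ e v → bit e + v) (exchangeBasis-removed i p) d[i]≡1+x)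
                         (cong suc (sym (Vecₚ.lookup∘update i d x)))
  ... | no j≢i   = trans (cong (λ e → bit e + lookup d j) (exchangeBasis-path p j j≢i))
                         (cong suc (sym (Vecₚ.lookup∘update′ j≢i d x)))

  exchangeBasis-parallel-bit : ∀ {b : Vec ℕ m} {p y} (i : Fin k) → lookup b p ≡ suc y → ∀ q →
    bit (lookup (exchangeBasis i p) (k ↑ʳ q)) + lookup (b [ p ]≔ y) q ≡ lookup b q
  exchangeBasis-parallel-bit {b} {p} {y} i b[p]≡1+y q with q Finₚ.≟ p
  ... | yes refl = trans (cong₂ (λ e v → bit e + v) (exchangeBasis-added i p) (Vecₚ.lookup∘update p b y)) (sym b[p]≡1+y)
  ... | no q≢p   = trans (cong (λ e → bit e + lookup (b [ p ]≔ y) q) (exchangeBasis-parallel i q q≢p))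
                         (Vecₚ.lookup∘update′ q≢p b y)

module _ {k m t : ℕ} where

  pathBasis-∷ : ∀ {d : Vec ℕ k} {b : Vec ℕ m} → Decomposition t d b → Decomposition (suc t) d b
  pathBasis-∷ {d} {b} D = record
    { bases                 = pathBasis k m ∷ bases
    ; all-bases             = pathBasis-isBasis ∷ all-bases
    ; length-bases          = cong suc length-bases
    ; path-multiplicity     = λ i → trans (cong (λ e → bit e + multiplicity bases (i ↑ˡ m) + lookup d i) (pathBasis-path i))
                                          (cong suc (path-multiplicity i))
    ; parallel-multiplicity = λ p → trans (cong (λ e → bit e + multiplicity bases (k ↑ʳ p)) (pathBasis-parallel {k} p))
                                          (parallel-multiplicity p)
    }
    where open Decomposition D

  exchangeBasis-∷ : ∀ {d : Vec ℕ k} {b : Vec ℕ m} {i p x y} → lookup d i ≡ suc x → lookup b p ≡ suc y →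
    Decomposition t (d [ i ]≔ x) (b [ p ]≔ y) → Decomposition (suc t) d b
  exchangeBasis-∷ {d} {b} {i} {p} d[i]≡1+x b[p]≡1+y D = record
    { bases                 = exchangeBasis i p ∷ bases
    ; all-bases             = exchangeBasis-isBasis i p ∷ all-bases
    ; length-bases          = cong suc length-bases
    ; path-multiplicity     = λ j → count-step (bit (lookup (exchangeBasis i p) (j ↑ˡ m)))
                                               (exchangeBasis-path-bit {d = d} p d[i]≡1+x j) (path-multiplicity j)
    ; parallel-multiplicity = λ q → trans (cong (bit (lookup (exchangeBasis i p) (k ↑ʳ q)) +_) (parallel-multiplicity q))
                                          (exchangeBasis-parallel-bit {b = b} i b[p]≡1+y q)
    }
    where open Decomposition D

decompose : ∀ {k m} t (d : Vec ℕ k) (b : Vec ℕ m) → Vec.sum d ≡ Vec.sum b → Vec.sum b ≤ t → Decomposition t d b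
decompose zero d b sum-d≡sum-b sum-b≤0 = record
  { bases                 = []
  ; all-bases             = []
  ; length-bases          = refl
  ; path-multiplicity     = sum≡0⇒lookup≡0 d (trans sum-d≡sum-b sum-b≡0)
  ; parallel-multiplicity = λ p → sym (sum≡0⇒lookup≡0 b sum-b≡0 p)
  }
  where
  sum-b≡0 : Vec.sum b ≡ 0
  sum-b≡0 = n≤0⇒n≡0 sum-b≤0
decompose (suc t) d b sum-d≡sum-b sum-b≤1+t with Vec.sum b in sum-b≡s
... | zero  = pathBasis-∷ (decompose t d b (trans sum-d≡sum-b (sym sum-b≡s)) (subst (_≤ t) (sym sum-b≡s) z≤n))
... | suc s =
  let i , x , d[i]≡1+x = sum≡suc⇒∃lookup≡suc d sum-d≡sum-b
      p , y , b[p]≡1+y = sum≡suc⇒∃lookup≡suc b sum-b≡s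
      sum-d′≡s = suc-injective (trans (sym (sum-[]≔-pred d i x d[i]≡1+x)) sum-d≡sum-b)
      sum-b′≡s = suc-injective (trans (sym (sum-[]≔-pred b p y b[p]≡1+y)) sum-b≡s)
  in exchangeBasis-∷ d[i]≡1+x b[p]≡1+y
       (decompose t (d [ i ]≔ x) (b [ p ]≔ y) (trans sum-d′≡s (sym sum-b′≡s)) (subst (_≤ t) (sym sum-b′≡s) (≤-pred sum-b≤1+t)))

point-lookup : ∀ {k m t} {d : Vec ℕ k} {b : Vec ℕ m} (D : Decomposition t d b) c →
  lookup (point t d b) c ≡ ℤ.+ multiplicity (Decomposition.bases D) c
point-lookup {k} {m} {t} {d} {b} D c with ↑-view k c
... | path i = begin
  lookup (point t d b) (i ↑ˡ m)
    ≡⟨ Vecₚ.lookup-++ˡ (Vec.map (complement t) d) (Vec.map ℤ.+_ b) i ⟩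
  lookup (Vec.map (complement t) d) i
    ≡⟨ Vecₚ.lookup-map i (complement t) d ⟩
  complement t (lookup d i)
    ≡⟨ cong (λ s → complement s (lookup d i)) (path-multiplicity i) ⟨
  complement (multiplicity bases (i ↑ˡ m) + lookup d i) (lookup d i)
    ≡⟨ complement-+ (multiplicity bases (i ↑ˡ m)) (lookup d i) ⟩
  ℤ.+ multiplicity bases (i ↑ˡ m) ∎
  where
  open Decomposition D
  open ≡-Reasoning
... | parallel p = begin
  lookup (point t d b) (k ↑ʳ p)
    ≡⟨ Vecₚ.lookup-++ʳ (Vec.map (complement t) d) (Vec.map ℤ.+_ b) p ⟩
  lookup (Vec.map ℤ.+_ b) p
    ≡⟨ Vecₚ.lookup-map p ℤ.+_ b ⟩
  ℤ.+ lookup b p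
    ≡⟨ cong ℤ.+_ (parallel-multiplicity p) ⟨
  ℤ.+ multiplicity bases (k ↑ʳ p) ∎
  where
  open Decomposition D
  open ≡-Reasoning

module _ {n : ℕ} (w : ℚ) where

  uniform : List (Vec Bool n) → List (ℚ × Vec Bool n)
  uniform = map (w ,_)

  totalWeight-uniform : ∀ Bs → sumℚ (map proj₁ (uniform Bs)) ≡ ℕtoℚ (length Bs) ℚ.* w
  totalWeight-uniform []       = sym (ℚP.*-zeroˡ w)
  totalWeight-uniform (B ∷ Bs) = begin
    w ℚ.+ sumℚ (map proj₁ (uniform Bs))     ≡⟨ cong (w ℚ.+_) (totalWeight-uniform Bs) ⟩
    w ℚ.+ ℕtoℚ (length Bs) ℚ.* w            ≡⟨ cong (ℚ._+ ℕtoℚ (length Bs) ℚ.* w) (ℚP.*-identityˡ w) ⟨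
    1ℚ ℚ.* w ℚ.+ ℕtoℚ (length Bs) ℚ.* w     ≡⟨ ℚP.*-distribʳ-+ w 1ℚ (ℕtoℚ (length Bs)) ⟨
    (1ℚ ℚ.+ ℕtoℚ (length Bs)) ℚ.* w         ≡⟨ cong (ℚ._* w) (ℕtoℚ-+ 1 (length Bs)) ⟨
    ℕtoℚ (suc (length Bs)) ℚ.* w            ∎
    where open ≡-Reasoning

  coordinate-uniform : ∀ Bs c →
    sumℚ (map (λ p → proj₁ p ℚ.* indicator (proj₂ p) c) (uniform Bs)) ≡ w ℚ.* ℕtoℚ (multiplicity Bs c)
  coordinate-uniform []       c = sym (ℚP.*-zeroʳ w)
  coordinate-uniform (B ∷ Bs) c = begin
    w ℚ.* indicator B c ℚ.+ sumℚ (map (λ p → proj₁ p ℚ.* indicator (proj₂ p) c) (uniform Bs))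
      ≡⟨ cong₂ ℚ._+_ (cong (w ℚ.*_) (indicator≡bit (lookup B c))) (coordinate-uniform Bs c) ⟩
    w ℚ.* ℕtoℚ (bit (lookup B c)) ℚ.+ w ℚ.* ℕtoℚ (multiplicity Bs c)
      ≡⟨ ℚP.*-distribˡ-+ w _ _ ⟨
    w ℚ.* (ℕtoℚ (bit (lookup B c)) ℚ.+ ℕtoℚ (multiplicity Bs c))
      ≡⟨ cong (w ℚ.*_) (ℕtoℚ-+ (bit (lookup B c)) (multiplicity Bs c)) ⟨
    w ℚ.* ℕtoℚ (multiplicity (B ∷ Bs) c) ∎
    where open ≡-Reasoning

point-isLatticePoint : ∀ {k m} t (d : Vec ℕ k) (b : Vec ℕ m) → Vec.sum d ≡ Vec.sum b → Vec.sum b ≤ t →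
  LatticePoint k (k + m) t (point t d b)
point-isLatticePoint {k} {m} zero d b sum-d≡sum-b sum-b≤0 =
  (1ℚ , pathBasis k m) ∷ [] , (ℕtoℚ-mono-≤ {0} {1} z≤n , pathBasis-isBasis) ∷ [] , ℚP.+-identityʳ 1ℚ , coordinate
  where
  D = decompose zero d b sum-d≡sum-b sum-b≤0
  coordinate : ∀ c → ℤtoℚ (lookup (point 0 d b) c) ≡ 0ℚ ℚ.* (1ℚ ℚ.* indicator (pathBasis k m) c ℚ.+ 0ℚ)
  coordinate c = trans (cong ℤtoℚ (point-lookup D c)) (sym (ℚP.*-zeroˡ (1ℚ ℚ.* indicator (pathBasis k m) c ℚ.+ 0ℚ)))
point-isLatticePoint (suc t) d b sum-d≡sum-b sum-b≤t =
  uniform w bases , Allₚ.map⁺ (All.map (w≥0 ,_) all-bases) , total≡1 , coordinate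
  where
  open Decomposition (decompose (suc t) d b sum-d≡sum-b sum-b≤t)
  w = ratio 1 (suc t)
  w≥0 : 0ℚ ℚ.≤ w
  w≥0 = ℚP.nonNegative⁻¹ w {{ℚP.normalize-nonNeg 1 (suc t)}}
  [1+t]w≡1 : ℕtoℚ (suc t) ℚ.* w ≡ 1ℚ
  [1+t]w≡1 = trans (ℚP.*-comm (ℕtoℚ (suc t)) w)
    (sym (ℕtoℚ-≡-ratio-* 1 t 1 (suc t) (trans (*-identityʳ (suc t)) (sym (*-identityˡ (suc t))))))
  total≡1 : sumℚ (map proj₁ (uniform w bases)) ≡ 1ℚ
  total≡1 = trans (totalWeight-uniform w bases) (trans (cong (λ l → ℕtoℚ l ℚ.* w) length-bases) [1+t]w≡1)
  coordinate : ∀ c → ℤtoℚ (lookup (point (suc t) d b) c) ≡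
    ℕtoℚ (suc t) ℚ.* sumℚ (map (λ p → proj₁ p ℚ.* indicator (proj₂ p) c) (uniform w bases))
  coordinate c = begin
    ℤtoℚ (lookup (point (suc t) d b) c)                        ≡⟨ cong ℤtoℚ (point-lookup (decompose (suc t) d b sum-d≡sum-b sum-b≤t) c) ⟩
    ℕtoℚ (multiplicity bases c)                                ≡⟨ ℚP.*-identityˡ _ ⟨
    1ℚ ℚ.* ℕtoℚ (multiplicity bases c)                         ≡⟨ cong (ℚ._* ℕtoℚ (multiplicity bases c)) [1+t]w≡1 ⟨
    ℕtoℚ (suc t) ℚ.* w ℚ.* ℕtoℚ (multiplicity bases c)         ≡⟨ ℚP.*-assoc (ℕtoℚ (suc t)) w _ ⟩
    ℕtoℚ (suc t) ℚ.* (w ℚ.* ℕtoℚ (multiplicity bases c))       ≡⟨ cong (ℕtoℚ (suc t) ℚ.*_) (coordinate-uniform w bases c) ⟨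
    ℕtoℚ (suc t) ℚ.* sumℚ (map (λ p → proj₁ p ℚ.* indicator (proj₂ p) c) (uniform w bases)) ∎
    where open ≡-Reasoning

-- Counting the lattice points

incrementHead : ∀ {k} → Vec ℕ (suc k) → Vec ℕ (suc k)
incrementHead (x ∷ xs) = suc x ∷ xs

compositions : (k s : ℕ) → List (Vec ℕ k)
compositions zero    zero    = [] ∷ []
compositions zero    (suc s) = []
compositions (suc k) zero    = replicate (suc k) 0 ∷ []
compositions (suc k) (suc s) = map (0 ∷_) (compositions k (suc s)) List.++ map incrementHead (compositions (suc k) s)

sum-replicate-0 : ∀ k → Vec.sum (replicate k 0) ≡ 0
sum-replicate-0 zero    = refl
sum-replicate-0 (suc k) = sum-replicate-0 k

sum≡0⇒replicate-0 : ∀ {k} (v : Vec ℕ k) → Vec.sum v ≡ 0 → v ≡ replicate k 0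
sum≡0⇒replicate-0 []      _     = refl
sum≡0⇒replicate-0 (x ∷ v) sum≡0 = cong₂ _∷_ (m+n≡0⇒m≡0 x sum≡0) (sum≡0⇒replicate-0 v (m+n≡0⇒n≡0 x sum≡0))

∈-compositions⁻ : ∀ k s {v} → v ∈ compositions k s → Vec.sum v ≡ s
∈-compositions⁻ zero    zero    {[]} _          = refl
∈-compositions⁻ (suc k) zero    (here refl)     = sum-replicate-0 (suc k)
∈-compositions⁻ (suc k) (suc s) v∈ with ∈-++⁻ (map (0 ∷_) (compositions k (suc s))) v∈
... | inj₁ v∈₁ with ∈-map⁻ (0 ∷_) v∈₁
...   | w , w∈ , refl = ∈-compositions⁻ k (suc s) w∈
∈-compositions⁻ (suc k) (suc s) v∈ | inj₂ v∈₂ with ∈-map⁻ incrementHead v∈₂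
...   | x ∷ w , w∈ , refl = cong suc (∈-compositions⁻ (suc k) s w∈)

∈-compositions⁺ : ∀ k s (v : Vec ℕ k) → Vec.sum v ≡ s → v ∈ compositions k s
∈-compositions⁺ zero    zero    []          _     = here refl
∈-compositions⁺ (suc k) zero    v           sum≡0 = here (sum≡0⇒replicate-0 v sum≡0)
∈-compositions⁺ (suc k) (suc s) (zero ∷ v)  sum≡s = ∈-++⁺ˡ (∈-map⁺ (0 ∷_) (∈-compositions⁺ k (suc s) v sum≡s))
∈-compositions⁺ (suc k) (suc s) (suc x ∷ v) sum≡s =
  ∈-++⁺ʳ (map (0 ∷_) (compositions k (suc s))) (∈-map⁺ incrementHead (∈-compositions⁺ (suc k) s (x ∷ v) (suc-injective sum≡s)))

compositions-unique : ∀ k s → Unique (compositions k s)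
compositions-unique zero    zero    = [] ∷ []
compositions-unique zero    (suc s) = []
compositions-unique (suc k) zero    = [] ∷ []
compositions-unique (suc k) (suc s) =
  Uniqueₚ.++⁺ (Uniqueₚ.map⁺ Vecₚ.∷-injectiveʳ (compositions-unique k (suc s)))
              (Uniqueₚ.map⁺ incrementHead-injective (compositions-unique (suc k) s))
              disjoint
  where
  incrementHead-injective : ∀ {x y : Vec ℕ (suc k)} → incrementHead x ≡ incrementHead y → x ≡ y
  incrementHead-injective {_ ∷ _} {_ ∷ _} refl = refl
  disjoint : ∀ {v} → ¬ (v ∈ map (0 ∷_) (compositions k (suc s)) × v ∈ map incrementHead (compositions (suc k) s))
  disjoint (v∈₁ , v∈₂) with ∈-map⁻ (0 ∷_) v∈₁ | ∈-map⁻ incrementHead v∈₂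
  ... | _ , _ , refl | _ ∷ _ , _ , ()

length-compositions : ∀ K s → length (compositions (suc K) s) ≡ (s + K) C K
length-compositions zero    zero    = refl
length-compositions zero    (suc s) =
  trans (Listₚ.length-++ (map (0 ∷_) (compositions 0 (suc s))) {map incrementHead (compositions 1 s)})
        (trans (Listₚ.length-map incrementHead (compositions 1 s)) (length-compositions zero s))
length-compositions (suc K) zero    = sym (nCn≡1 (suc K))
length-compositions (suc K) (suc s) = begin
  length (map (0 ∷_) (compositions (suc K) (suc s)) List.++ map incrementHead (compositions (suc (suc K)) s))
    ≡⟨ Listₚ.length-++ (map (0 ∷_) (compositions (suc K) (suc s))) ⟩
  length (map (0 ∷_) (compositions (suc K) (suc s))) + length (map incrementHead (compositions (suc (suc K)) s))
    ≡⟨ cong₂ _+_ (trans (Listₚ.length-map (0 ∷_) (compositions (suc K) (suc s))) (length-compositions K (suc s)))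
                 (trans (Listₚ.length-map incrementHead (compositions (suc (suc K)) s)) (length-compositions (suc K) s)) ⟩
  (suc s + K) C K + (s + suc K) C suc K
    ≡⟨ cong (λ x → (suc s + K) C K + x C suc K) (+-suc s K) ⟩
  suc (s + K) C K + suc (s + K) C suc K
    ≡⟨ pascal (suc (s + K)) K ⟨
  suc (suc (s + K)) C suc K
    ≡⟨ cong (_C suc K) (+-suc (suc s) K) ⟨
  (suc s + suc K) C suc K ∎
  where open ≡-Reasoning

length-cartesianProduct : ∀ {A B : Set} (xs : List A) (ys : List B) →
  length (cartesianProduct xs ys) ≡ length xs * length ys
length-cartesianProduct []       ys = refl
length-cartesianProduct (x ∷ xs) ys =
  trans (Listₚ.length-++ (map (x ,_) ys)) (cong₂ _+_ (Listₚ.length-map (x ,_) ys) (length-cartesianProduct xs ys))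

module BalancedPairs (k m : ℕ) where

  pairsOfSum : ℕ → List (Vec ℕ k × Vec ℕ m)
  pairsOfSum s = cartesianProduct (compositions k s) (compositions m s)

  balancedPairs : ℕ → List (Vec ℕ k × Vec ℕ m)
  balancedPairs zero    = pairsOfSum 0
  balancedPairs (suc t) = balancedPairs t List.++ pairsOfSum (suc t)

  ∈-pairsOfSum⁻ : ∀ s {d b} → (d , b) ∈ pairsOfSum s → Vec.sum d ≡ s × Vec.sum b ≡ s
  ∈-pairsOfSum⁻ s db∈ with ∈-cartesianProduct⁻ (compositions k s) (compositions m s) db∈
  ... | d∈ , b∈ = ∈-compositions⁻ k s d∈ , ∈-compositions⁻ m s b∈

  ∈-balancedPairs⁻ : ∀ t {d b} → (d , b) ∈ balancedPairs t → Vec.sum d ≡ Vec.sum b × Vec.sum b ≤ t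
  ∈-balancedPairs⁻ zero    db∈ with ∈-pairsOfSum⁻ 0 db∈
  ... | sum-d≡0 , sum-b≡0 = trans sum-d≡0 (sym sum-b≡0) , ≤-reflexive sum-b≡0
  ∈-balancedPairs⁻ (suc t) db∈ with ∈-++⁻ (balancedPairs t) db∈
  ... | inj₁ db∈₁ = let sum-d≡sum-b , sum-b≤t = ∈-balancedPairs⁻ t db∈₁ in sum-d≡sum-b , m≤n⇒m≤1+n sum-b≤t
  ... | inj₂ db∈₂ =
    let sum-d≡1+t , sum-b≡1+t = ∈-pairsOfSum⁻ (suc t) db∈₂ in trans sum-d≡1+t (sym sum-b≡1+t) , ≤-reflexive sum-b≡1+t

  ∈-pairsOfSum⁺ : ∀ s (d : Vec ℕ k) (b : Vec ℕ m) → Vec.sum d ≡ s → Vec.sum b ≡ s → (d , b) ∈ pairsOfSum s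
  ∈-pairsOfSum⁺ s d b sum-d≡s sum-b≡s = ∈-cartesianProduct⁺ (∈-compositions⁺ k s d sum-d≡s) (∈-compositions⁺ m s b sum-b≡s)

  ∈-balancedPairs⁺ : ∀ t (d : Vec ℕ k) (b : Vec ℕ m) → Vec.sum d ≡ Vec.sum b → Vec.sum b ≤ t → (d , b) ∈ balancedPairs t
  ∈-balancedPairs⁺ zero    d b sum-d≡sum-b sum-b≤0 =
    ∈-pairsOfSum⁺ 0 d b (trans sum-d≡sum-b (n≤0⇒n≡0 sum-b≤0)) (n≤0⇒n≡0 sum-b≤0)
  ∈-balancedPairs⁺ (suc t) d b sum-d≡sum-b sum-b≤1+t with m≤n⇒m<n∨m≡n sum-b≤1+t
  ... | inj₁ sum-b<1+t = ∈-++⁺ˡ (∈-balancedPairs⁺ t d b sum-d≡sum-b (≤-pred sum-b<1+t))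
  ... | inj₂ sum-b≡1+t = ∈-++⁺ʳ (balancedPairs t) (∈-pairsOfSum⁺ (suc t) d b (trans sum-d≡sum-b sum-b≡1+t) sum-b≡1+t)

  balancedPairs-unique : ∀ t → Unique (balancedPairs t)
  balancedPairs-unique zero    = Uniqueₚ.cartesianProduct⁺ (compositions-unique k 0) (compositions-unique m 0)
  balancedPairs-unique (suc t) =
    Uniqueₚ.++⁺ (balancedPairs-unique t)
                (Uniqueₚ.cartesianProduct⁺ (compositions-unique k (suc t)) (compositions-unique m (suc t)))
                disjoint
    where
    disjoint : ∀ {db} → ¬ (db ∈ balancedPairs t × db ∈ pairsOfSum (suc t))
    disjoint (db∈₁ , db∈₂) =
      <-irrefl refl (subst (_≤ t) (proj₂ (∈-pairsOfSum⁻ (suc t) db∈₂)) (proj₂ (∈-balancedPairs⁻ t db∈₁)))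

  length-balancedPairs : ∀ t → length (balancedPairs t) ≡ ∑[ s < suc t ] (length (compositions k (toℕ s)) * length (compositions m (toℕ s)))
  length-balancedPairs zero    = trans (length-cartesianProduct (compositions k 0) (compositions m 0)) (sym (+-identityʳ _))
  length-balancedPairs (suc t) = begin
    length (balancedPairs t List.++ pairsOfSum (suc t))
      ≡⟨ Listₚ.length-++ (balancedPairs t) ⟩
    length (balancedPairs t) + length (pairsOfSum (suc t))
      ≡⟨ cong₂ _+_ (length-balancedPairs t) (length-cartesianProduct (compositions k (suc t)) (compositions m (suc t))) ⟩
    ∑[ s < suc t ] (length (compositions k (toℕ s)) * length (compositions m (toℕ s)))
      + length (compositions k (suc t)) * length (compositions m (suc t))
      ≡⟨ ∑-snoc (suc t) (λ s → length (compositions k s) * length (compositions m s)) ⟨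
    ∑[ s < suc (suc t) ] (length (compositions k (toℕ s)) * length (compositions m (toℕ s))) ∎
    where open ≡-Reasoning

map-injective : ∀ {A B : Set} {r} (f : A → B) → (∀ {x y} → f x ≡ f y → x ≡ y) →
  ∀ {xs ys : Vec A r} → Vec.map f xs ≡ Vec.map f ys → xs ≡ ys
map-injective f f-inj {[]}     {[]}     _  = refl
map-injective f f-inj {x ∷ xs} {y ∷ ys} eq =
  cong₂ _∷_ (f-inj (Vecₚ.∷-injectiveˡ eq)) (map-injective f f-inj (Vecₚ.∷-injectiveʳ eq))

point-injective : ∀ {k m} t {d d′ : Vec ℕ k} {b b′ : Vec ℕ m} → point t d b ≡ point t d′ b′ → (d , b) ≡ (d′ , b′)
point-injective t {d} {d′} eq with Vecₚ.++-injective (Vec.map (complement t) d) (Vec.map (complement t) d′) eq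
... | path-eq , parallel-eq =
  cong₂ _,_ (map-injective (complement t) (complement-injective t) path-eq) (map-injective ℤ.+_ ℤP.+-injective parallel-eq)

module _ (k m t : ℕ) where

  open BalancedPairs k m

  latticePoints : List (Vec ℤ (k + m))
  latticePoints = map (uncurry (point t)) (balancedPairs t)

  latticePoints-enumerates : HasCardinality (LatticePoint k (k + m) t) (length latticePoints)
  latticePoints-enumerates =
    latticePoints , Uniqueₚ.map⁺ (point-injective t) (balancedPairs-unique t) , (λ z → mk⇔ (sound z) (complete z)) , refl
    where
    sound : ∀ z → z ∈ latticePoints → LatticePoint k (k + m) t z
    sound z z∈ with ∈-map⁻ (uncurry (point t)) z∈
    ... | (d , b) , db∈ , refl =
      let sum-d≡sum-b , sum-b≤t = ∈-balancedPairs⁻ t db∈ in point-isLatticePoint t d b sum-d≡sum-b sum-b≤t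
    complete : ∀ z → LatticePoint k (k + m) t z → z ∈ latticePoints
    complete z lp with LatticePoint⇒point t z lp
    ... | d , b , sum-d≡sum-b , sum-b≤t , refl = ∈-map⁺ (uncurry (point t)) (∈-balancedPairs⁺ t d b sum-d≡sum-b sum-b≤t)

length-latticePoints : ∀ K M t →
  length (latticePoints (suc K) (suc M) t) ≡ ∑[ s < suc t ] (((toℕ s + K) C K) * ((toℕ s + M) C M))
length-latticePoints K M t = begin
  length (map (uncurry (point t)) (balancedPairs t))
    ≡⟨ Listₚ.length-map (uncurry (point t)) (balancedPairs t) ⟩
  length (balancedPairs t)
    ≡⟨ length-balancedPairs t ⟩
  ∑[ s < suc t ] (length (compositions (suc K) (toℕ s)) * length (compositions (suc M) (toℕ s)))
    ≡⟨ sum-cong-≗ {suc t} (λ s → cong₂ _*_ (length-compositions K (toℕ s)) (length-compositions M (toℕ s))) ⟩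
  ∑[ s < suc t ] (((toℕ s + K) C K) * ((toℕ s + M) C M)) ∎
  where
  open ≡-Reasoning
  open BalancedPairs (suc K) (suc M)

ℕtoℚ-weighted-term : ∀ t K M j →
  ℕtoℚ ((K C j) * ∑[ s < suc t ] (((toℕ s + M) C M) * (toℕ s C j))) ≡
  ℕtoℚ ((t + suc M) C suc M) ℚ.* (ratio (suc M) (suc M + j) ℚ.* ℕtoℚ (t C j) ℚ.* ℕtoℚ (K C j))
ℕtoℚ-weighted-term t K M j = begin
  ℕtoℚ ((K C j) * weighted)
    ≡⟨ ℕtoℚ-* (K C j) weighted ⟩
  ℕtoℚ (K C j) ℚ.* ℕtoℚ weighted
    ≡⟨ cong (ℕtoℚ (K C j) ℚ.*_) (ℕtoℚ-≡-ratio-* (suc M) (M + j) weighted _ (weighted-hockey-stick-scaled t M j)) ⟩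
  ℕtoℚ (K C j) ℚ.* (ratio (suc M) (suc M + j) ℚ.* ℕtoℚ (((t + suc M) C suc M) * (t C j)))
    ≡⟨ cong (λ x → ℕtoℚ (K C j) ℚ.* (ratio (suc M) (suc M + j) ℚ.* x)) (ℕtoℚ-* ((t + suc M) C suc M) (t C j)) ⟩
  ℕtoℚ (K C j) ℚ.* (ratio (suc M) (suc M + j) ℚ.* (ℕtoℚ ((t + suc M) C suc M) ℚ.* ℕtoℚ (t C j)))
    ≡⟨ rearrange (ℕtoℚ (K C j)) (ratio (suc M) (suc M + j)) (ℕtoℚ ((t + suc M) C suc M)) (ℕtoℚ (t C j)) ⟩
  ℕtoℚ ((t + suc M) C suc M) ℚ.* (ratio (suc M) (suc M + j) ℚ.* ℕtoℚ (t C j) ℚ.* ℕtoℚ (K C j)) ∎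
  where
  open ≡-Reasoning
  weighted = ∑[ s < suc t ] (((toℕ s + M) C M) * (toℕ s C j))
  rearrange : ∀ a r c u → a ℚ.* (r ℚ.* (c ℚ.* u)) ≡ c ℚ.* (r ℚ.* u ℚ.* a)
  rearrange = solve 4 (λ a r c u → a :* (r :* (c :* u)) := c :* (r :* u :* a)) refl
    where open +-*-Solver

count-formula : ∀ t K M →
  ℕtoℚ (∑[ s < suc t ] (((toℕ s + K) C K) * ((toℕ s + M) C M))) ≡ Dformula (suc K) (suc K + suc M) t
count-formula t K M = begin
  ℕtoℚ (∑[ s < suc t ] (((toℕ s + K) C K) * ((toℕ s + M) C M)))
    ≡⟨ cong ℕtoℚ (∑-product-binomials t K M) ⟩
  ℕtoℚ (∑[ j < suc K ] ((K C toℕ j) * ∑[ s < suc t ] (((toℕ s + M) C M) * (toℕ s C toℕ j))))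
    ≡⟨ ℕtoℚ-sum (suc K) (λ j → (K C toℕ j) * ∑[ s < suc t ] (((toℕ s + M) C M) * (toℕ s C toℕ j))) ⟩
  ℚΣ.sum {suc K} (λ j → ℕtoℚ ((K C toℕ j) * ∑[ s < suc t ] (((toℕ s + M) C M) * (toℕ s C toℕ j))))
    ≡⟨ ℚΣ.sum-cong-≗ {suc K} (ℕtoℚ-weighted-term t K M ∘ toℕ) ⟩
  ℚΣ.sum {suc K} (λ j → C[t+m,m] ℚ.* summand (toℕ j))
    ≡⟨ ℚΣ.*-distribˡ-sum {suc K} C[t+m,m] (summand ∘ toℕ) ⟨
  C[t+m,m] ℚ.* ℚΣ.sum {suc K} (summand ∘ toℕ)
    ≡⟨ cong (C[t+m,m] ℚ.*_) (sumℚ-map-applyUpTo (suc K) (λ j → j) summand) ⟨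
  C[t+m,m] ℚ.* sumℚ (map summand (upTo (suc K)))
    ≡⟨ cong (λ m → ℕtoℚ ((t + m) C m) ℚ.* sumℚ (map (λ j → ratio m (m + j) ℚ.* ℕtoℚ (t C j) ℚ.* ℕtoℚ (K C j)) (upTo (suc K))))
            (m+n∸m≡n (suc K) (suc M)) ⟨
  Dformula (suc K) (suc K + suc M) t ∎
  where
  open ≡-Reasoning
  C[t+m,m] : ℚ
  C[t+m,m] = ℕtoℚ ((t + suc M) C suc M)
  summand : ℕ → ℚ
  summand j = ratio (suc M) (suc M + j) ℚ.* ℕtoℚ (t C j) ℚ.* ℕtoℚ (K C j)

lemma3p2 : (k n : ℕ) → 1 ≤ k → k < n →
    ∀ (t : ℕ) → Σ ℕ λ N → HasCardinality (LatticePoint k n t) N × ℕtoℚ N ≡ Dformula k n t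
lemma3p2 (suc K) n (s≤s z≤n) k<n t =
  subst (λ n → Σ ℕ λ N → HasCardinality (LatticePoint (suc K) n t) N × ℕtoℚ N ≡ Dformula (suc K) n t) k+m≡n
    (length (latticePoints (suc K) (suc M) t) ,
     latticePoints-enumerates (suc K) (suc M) t ,
     trans (cong ℕtoℚ (length-latticePoints K M t)) (count-formula t K M))
  where
  M = n ∸ suc (suc K)
  k+m≡n : suc K + suc M ≡ n
  k+m≡n = trans (+-suc (suc K) M) (m+[n∸m]≡n k<n)
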